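{- Let $\mathrm{itc}_{n,d,k}=|\mathsf{ITC}_{n,d,k}|$ and $\mathrm{itc}_{n,d}=|\mathsf{ITC}_{n,d}|$. Then $\mathrm{itc}_{n,d,1}=1$, for $k\ge2$ \[ \mathrm{itc}_{n,d,k}=\binom{d+k-2}{d-1}\binom{n-1}{k-2}+\binom{d+k-1}{d}\binom{n-1}{k-1}, \] and \[ \mathrm{itc}_{n,d}=\sum_{k=1}^n\binom{d+k}{d}\binom{n-1}{k-1}. \]
   Context: Let $n\ge1$ and $d\ge0$ be integers; binomial coefficients $\binom{m}{r}$ with $r<0$ or $r>m\ge0$ are $0$. The complete split graph $S_{n,d}$ has vertices $s,v_1,\ldots,v_n$ and $w_1,\ldots,w_d$; any two distinct vertices among $s,v_1,\ldots,v_n$ are adjacent, each $w_j$ is adjacent to each of $s,v_1,\ldots,v_n$, no two $w_j$'s are adjacent; $s$ is the sink, $\deg(v_i)=n+d$, $\deg(w_j)=n+1$. A configuration assigns non-negative integers to non-sink vertices. A non-sink vertex is unstable if its number of grains is $\ge$ its degree; toppling $v$ removes $\deg(v)$ grains from $v$ (if $v\ne s$) and adds one grain to each non-sink neighbour. A stable configuration $c$ is recurrent iff there is an ordering $s=u_0,\ldots,u_{n+d}$ of all vertices such that from $c$, toppling $u_0,\ldots,u_{i-1}$ in turn makes $u_i$ unstable for each $i\ge1$. $\mathsf{SortedRec}(S_{n,d})$: recurrent configurations $(c(v_1),\ldots,c(v_n);c(w_1),\ldots,c(w_d))$ with both parts weakly decreasing. ITC toppling of $c$: topple the sink; then for $i=1,2,\ldots$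 topple simultaneously the set $Q'_i$ of currently unstable independent vertices, then the set $P'_i$ of currently unstable clique vertices; stop after the first $i=k$ at which the configuration is stable. The ITC-toppling sequence of $c$ is $[(|Q'_1|,\ldots,|Q'_k|),(|P'_1|,\ldots,|P'_k|)]$, of length $k$. $\mathsf{ITC}_{n,d,k}$ is the set of ITC-toppling sequences of length $k$ of elements of $\mathsf{SortedRec}(S_{n,d})$, and $\mathsf{ITC}_{n,d}=\bigcup_{k\ge1}\mathsf{ITC}_{n,d,k}$. -}

module Defs where

open import Data.Nat using (ℕ; zero; suc; _+_; _∸_; _≤_; _<_; _≤?_)
open import Data.Nat.Combinatorics using (_C_)
open import Data.Integer using (ℤ; +_; -[1+_])
open import Data.Fin using (Fin; _≟_)
import Data.Fin as F
open import Data.Bool using (Bool; true; false; if_then_else_)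
open import Data.List using (List; []; _∷_; length; map; upTo)
open import Data.Nat.ListAction using (sum)
open import Data.List.Membership.Propositional using (_∈_)
open import Data.List.Relation.Unary.Unique.Propositional using (Unique)
open import Data.Product using (Σ; _×_; _,_; ∃)
open import Data.Unit using (⊤)
open import Data.Empty using (⊥)
open import Relation.Nullary using (¬_; does)
open import Relation.Binary.PropositionalEquality using (_≡_)
open import Function.Bundles using (_⇔_)

-- Binomial coefficient with a possibly negative lower index
-- (value 0 when the lower index is negative; stdlib's m C r is 0 for r > m).

binomℤ : ℕ → ℤ → ℕ
binomℤ m (+ r)    = m C r
binomℤ m -[1+ _ ] = 0

-- The complete split graph S_{n,d}.
-- Clique vertices v_1..v_n are  clq i  (i : Fin n), independent vertices
-- w_1..w_d are  ind j  (j : Fin d), and  sink  is s.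

data Vertex (n d : ℕ) : Set where
  sink : Vertex n d
  clq  : Fin n → Vertex n d
  ind  : Fin d → Vertex n d

degC : ℕ → ℕ → ℕ
degC n d = n + d

degI : ℕ → ℕ → ℕ
degI n d = n + 1

record Config (n d : ℕ) : Set where
  constructor cfg
  field
    cc : Fin n → ℕ
    ci : Fin d → ℕ
open Config public

grains : ∀ {n d} → Config n d → Vertex n d → ℕ
grains c sink    = 0
grains c (clq i) = cc c i
grains c (ind j) = ci c j

Unstable : ∀ {n d} → Config n d → Vertex n d → Set
Unstable {n} {d} c sink    = ⊥
Unstable {n} {d} c (clq i) = degC n d ≤ cc c i
Unstable {n} {d} c (ind j) = degI n d ≤ ci c j

Stable : ∀ {n d} → Config n d → Set
Stable {n} {d} c = (∀ i → cc c i < degC n d) × (∀ j → ci c j < degI n d)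

topple : ∀ {n d} → Config n d → Vertex n d → Config n d
topple {n} {d} c sink =
  cfg (λ i → suc (cc c i)) (λ j → suc (ci c j))
topple {n} {d} c (clq i) =
  cfg (λ i' → if does (i' ≟ i) then cc c i' ∸ degC n d else suc (cc c i'))
      (λ j → suc (ci c j))
topple {n} {d} c (ind j) =
  cfg (λ i → suc (cc c i))
      (λ j' → if does (j' ≟ j) then ci c j' ∸ degI n d else ci c j')

LegalFrom : ∀ {n d} → Config n d → List (Vertex n d) → Set
LegalFrom c []       = ⊤
LegalFrom c (u ∷ us) = Unstable c u × LegalFrom (topple c u) us

Recurrent : ∀ {n d} → Config n d → Set
Recurrent {n} {d} c =
  Stable c ×
  Σ (List (Vertex n d)) λ us →
    Unique (sink ∷ us) × (∀ v → v ∈ (sink ∷ us)) × LegalFrom (topple c sink) us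

WeaklyDecreasing : ∀ {m} → (Fin m → ℕ) → Set
WeaklyDecreasing {m} f = ∀ (i j : Fin m) → i F.≤ j → f j ≤ f i

SortedRec : ∀ {n d} → Config n d → Set
SortedRec c = Recurrent c × WeaklyDecreasing (cc c) × WeaklyDecreasing (ci c)

unstableB : ℕ → ℕ → Bool
unstableB deg x = does (deg ≤? x)

countTrue : ∀ {m} → (Fin m → Bool) → ℕ
countTrue {zero}  f = 0
countTrue {suc m} f = (if f F.zero then 1 else 0) + countTrue (λ i → f (F.suc i))

QSet : ∀ {n d} → Config n d → Fin d → Bool
QSet {n} {d} c j = unstableB (degI n d) (ci c j)

PSet : ∀ {n d} → Config n d → Fin n → Bool
PSet {n} {d} c i = unstableB (degC n d) (cc c i)

toppleI : ∀ {n d} → Config n d → (Fin d → Bool) → Config n d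
toppleI {n} {d} c Q =
  cfg (λ i → cc c i + countTrue Q)
      (λ j → if Q j then ci c j ∸ degI n d else ci c j)

toppleC : ∀ {n d} → Config n d → (Fin n → Bool) → Config n d
toppleC {n} {d} c P =
  cfg (λ i → if P i then (cc c i + (countTrue P ∸ 1)) ∸ degC n d
                    else cc c i + countTrue P)
      (λ j → ci c j + countTrue P)

afterQ : ∀ {n d} → Config n d → Config n d
afterQ c = toppleI c (QSet c)

afterQP : ∀ {n d} → Config n d → Config n d
afterQP c = toppleC (afterQ c) (PSet (afterQ c))

-- ITCRun c qs ps : starting from c (the sink already toppled), the rounds
-- produce the sizes qs = (|Q'_1|,...,|Q'_k|), ps = (|P'_1|,...,|P'_k|),
-- stopping after the first round ending in a stable configuration.
data ITCRun {n d : ℕ} : Config n d → List ℕ → List ℕ → Set where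
  stop : ∀ {c} → Stable (afterQP c) →
         ITCRun c (countTrue (QSet c) ∷ []) (countTrue (PSet (afterQ c)) ∷ [])
  next : ∀ {c qs ps} → ¬ Stable (afterQP c) → ITCRun (afterQP c) qs ps →
         ITCRun c (countTrue (QSet c) ∷ qs) (countTrue (PSet (afterQ c)) ∷ ps)

ITCSeq : ∀ {n d} → Config n d → List ℕ × List ℕ → Set
ITCSeq c (qs , ps) = ITCRun (topple c sink) qs ps

ITCk : (n d k : ℕ) → List ℕ × List ℕ → Set
ITCk n d k (qs , ps) =
  Σ (Config n d) λ c → SortedRec c × ITCSeq c (qs , ps) × length qs ≡ k

ITCall : (n d : ℕ) → List ℕ × List ℕ → Set
ITCall n d s = Σ ℕ λ k → 1 ≤ k × ITCk n d k s

HasCard : {A : Set} → (A → Set) → ℕ → Set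
HasCard {A} P m =
  Σ (List A) λ L → Unique L × length L ≡ m × (∀ x → (x ∈ L ⇔ P x))

sumFrom1 : ℕ → (ℕ → ℕ) → ℕ
sumFrom1 n f = sum (map (λ j → f (suc j)) (upTo n))

{-# OPTIONS --safe #-}
module Submission where

-- Firing the sink of a recurrent configuration c and stabilising fires every other vertex
-- exactly once: a fired vertex stays stable, since c is stable and it receives at most one
-- grain from each other vertex, and every vertex of the legal order witnessing recurrence
-- must fire.  So the ITC sizes (q_i) and (p_i) are compositions of d and n; moreover
-- p_i ≥ 1 for i < k, since a round firing no clique vertex ends in a stable configuration,
-- and p_k + q_k ≥ 1.  Conversely every such well-shaped pair is the ITC sequence of the
-- sorted recurrent configuration in which each vertex is one grain short of what it
-- receives up to its round.  The well-shaped pairs of length k have either all p_i ≥ 1,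
-- C(n-1,k-1) C(d+k-1,d) of them, or p_k = 0 and q_k ≥ 1, C(n-1,k-2) C(d+k-2,d-1) of them;
-- grouping all lengths by the number of positive p_i and applying Pascal's rule gives the
-- total.

open import Defs
open import Data.Nat using (ℕ; zero; suc; pred; _+_; _*_; _∸_; _≤_; _<_; _≟_; _≤?_; _<?_; z≤n; s≤s)
open import Data.Nat.Properties
open import Data.Nat.Combinatorics using (_C_; nCn≡1; nCk≡nC[n∸k]; nCk+nC[k+1]≡[n+1]C[k+1])
open import Data.Nat.Combinatorics.Specification using (k>n⇒nCk≡0)
open import Data.Nat.ListAction using (sum)
open import Data.Nat.Tactic.RingSolver using (solve-∀)

open import Data.Fin using (Fin; toℕ; fromℕ<) renaming (zero to fzero; suc to fsuc)
import Data.Fin as Fin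
import Data.Fin.Properties as Fin
open import Data.Bool using (Bool; true; false; if_then_else_; _∨_)
open import Data.Bool.Properties using (¬-not; not-¬)
open import Data.Product using (Σ; _×_; _,_; proj₁; proj₂)
import Data.Integer as ℤ
open import Data.Sum using (_⊎_; inj₁; inj₂)
open import Data.Empty using (⊥; ⊥-elim)
open import Data.Unit using (⊤; tt)
open import Data.List using (List; []; _∷_; length; _++_; map; replicate; _∷ʳ_; cartesianProductWith; concatMap; upTo)
open import Data.List.Properties
  using (length-++; length-map; length-replicate; map-injective; ∷ʳ-injectiveˡ; map-cong; ∷-injective; foldr-∷ʳ)
open import Data.List.Relation.Unary.All using (All; []; _∷_)
import Data.List.Relation.Unary.All as All
import Data.List.Relation.Unary.All.Properties as All
open import Data.List.Relation.Unary.Any using (here; there)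
open import Data.List.Relation.Unary.AllPairs using ([]; _∷_)
open import Data.List.Membership.Propositional using (_∈_; find; lose)
open import Data.List.Membership.Propositional.Properties
  using ( ∈-++⁺ˡ; ∈-++⁺ʳ; ∈-++⁻; ∈-map⁺; ∈-map⁻; ∈-upTo⁺; ∈-cartesianProductWith⁺; ∈-cartesianProductWith⁻
        ; ∈-concatMap⁺; ∈-concatMap⁻)
open import Data.List.Relation.Unary.Unique.Propositional using (Unique)
import Data.List.Relation.Unary.Unique.Propositional.Properties as Unique
open import Relation.Nullary using (¬_; does; yes; no; Dec; contradiction)
open import Relation.Nullary.Decidable using (dec-true; dec-false)
open import Relation.Binary.PropositionalEquality
open import Function.Bundles using (_⇔_; mk⇔; Equivalence)
import Function.Properties.Equivalence as ⇔
open import Algebra.Properties.CommutativeSemigroup +-commutativeSemigroup using (xy∙z≈xz∙y; x∙yz≈y∙xz)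

-- Subsets of Fin m as Boolean predicates

dec-true⁻¹ : ∀ {A : Set} (a? : Dec A) → does a? ≡ true → A
dec-true⁻¹ (yes a) _ = a

dec-false⁻¹ : ∀ {A : Set} (a? : Dec A) → does a? ≡ false → ¬ A
dec-false⁻¹ (no ¬a) _ = ¬a

if-true : ∀ {A : Set} {b} {x y : A} → b ≡ true → (if b then x else y) ≡ x
if-true refl = refl

if-false : ∀ {A : Set} {b} {x y : A} → b ≡ false → (if b then x else y) ≡ y
if-false refl = refl

∨-trueˡ : ∀ {a} b → a ≡ true → (a ∨ b) ≡ true
∨-trueˡ b refl = refl

∨-trueʳ : ∀ a {b} → b ≡ true → (a ∨ b) ≡ true
∨-trueʳ true  _    = refl
∨-trueʳ false refl = refl

∨-true⁻ : ∀ a b → (a ∨ b) ≡ true → a ≡ true ⊎ b ≡ true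
∨-true⁻ true  b _ = inj₁ refl
∨-true⁻ false b e = inj₂ e

Disjoint : ∀ {m} → (Fin m → Bool) → (Fin m → Bool) → Set
Disjoint f g = ∀ i → f i ≡ true → g i ≡ false

_⊆_ : ∀ {m} → (Fin m → Bool) → (Fin m → Bool) → Set
f ⊆ g = ∀ i → f i ≡ true → g i ≡ true

countTrue-cong : ∀ {m} {f g : Fin m → Bool} → (∀ i → f i ≡ g i) → countTrue f ≡ countTrue g
countTrue-cong {zero}          f≗g = refl
countTrue-cong {suc m} {f} {g} f≗g rewrite f≗g fzero =
  cong ((if g fzero then 1 else 0) +_) (countTrue-cong (λ i → f≗g (fsuc i)))

countTrue≤ : ∀ {m} (f : Fin m → Bool) → countTrue f ≤ m
countTrue≤ {zero}  f = z≤n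
countTrue≤ {suc m} f with f fzero
... | true  = s≤s (countTrue≤ (λ i → f (fsuc i)))
... | false = m≤n⇒m≤1+n (countTrue≤ (λ i → f (fsuc i)))

countTrue-∨ : ∀ {m} (f g : Fin m → Bool) → Disjoint f g →
              countTrue (λ i → f i ∨ g i) ≡ countTrue f + countTrue g
countTrue-∨ {zero}  f g f#g = refl
countTrue-∨ {suc m} f g f#g with f fzero in ef | g fzero in eg
... | true  | true  with () ← trans (sym eg) (f#g fzero ef)
... | true  | false = cong suc (countTrue-∨ _ _ (λ i → f#g (fsuc i)))
... | false | true  = trans (cong suc (countTrue-∨ _ _ (λ i → f#g (fsuc i)))) (sym (+-suc _ _))
... | false | false = countTrue-∨ _ _ (λ i → f#g (fsuc i))

countTrue-mono : ∀ {m} (f g : Fin m → Bool) → f ⊆ g → countTrue f ≤ countTrue g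
countTrue-mono {zero}  f g f⊆g = z≤n
countTrue-mono {suc m} f g f⊆g with f fzero in ef | g fzero in eg
... | true  | true  = s≤s (countTrue-mono _ _ (λ i → f⊆g (fsuc i)))
... | true  | false with () ← trans (sym eg) (f⊆g fzero ef)
... | false | true  = m≤n⇒m≤1+n (countTrue-mono _ _ (λ i → f⊆g (fsuc i)))
... | false | false = countTrue-mono _ _ (λ i → f⊆g (fsuc i))

countTrue-positive : ∀ {m} (f : Fin m → Bool) i → f i ≡ true → 1 ≤ countTrue f
countTrue-positive f fzero    e rewrite e = s≤s z≤n
countTrue-positive f (fsuc i) e with f fzero
... | true  = s≤s z≤n
... | false = countTrue-positive (λ i → f (fsuc i)) i e

countTrue≡0⇒false : ∀ {m} (f : Fin m → Bool) → countTrue f ≡ 0 → ∀ i → f i ≡ false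
countTrue≡0⇒false f e fzero with f fzero
... | false = refl
countTrue≡0⇒false f e (fsuc i) with f fzero
... | false = countTrue≡0⇒false (λ i → f (fsuc i)) e i

countTrue-full : ∀ {m} (f : Fin m → Bool) → (∀ i → f i ≡ true) → countTrue f ≡ m
countTrue-full {zero}  f _    = refl
countTrue-full {suc m} f full rewrite full fzero = cong suc (countTrue-full _ (λ i → full (fsuc i)))

countTrue-empty : ∀ {m} (f : Fin m → Bool) → (∀ i → f i ≡ false) → countTrue f ≡ 0
countTrue-empty {zero}  f _     = refl
countTrue-empty {suc m} f empty rewrite empty fzero = countTrue-empty _ (λ i → empty (fsuc i))

∅ : ∀ {m} → Fin m → Bool
∅ _ = false

countTrue-∅ : ∀ {m} → countTrue (∅ {m}) ≡ 0
countTrue-∅ {m} = countTrue-empty {m} ∅ (λ _ → refl)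

below : ∀ {m} → ℕ → Fin m → Bool
below a i = does (toℕ i <? a)

below-true : ∀ {m} a (i : Fin m) → toℕ i < a → below a i ≡ true
below-true a i = dec-true (toℕ i <? a)

below-false : ∀ {m} a (i : Fin m) → ¬ toℕ i < a → below a i ≡ false
below-false a i = dec-false (toℕ i <? a)

below-0 : ∀ {m} (i : Fin m) → ∅ i ≡ below 0 i
below-0 i = sym (below-false 0 i λ ())

countTrue-below : ∀ {m} a → a ≤ m → countTrue (below {m} a) ≡ a
countTrue-below {zero}  zero    _         = refl
countTrue-below {suc m} zero    _         = countTrue-empty {suc m} (below 0) (λ i → below-false 0 i λ ())
countTrue-below {suc m} (suc a) (s≤s a≤m) rewrite below-true (suc a) (fzero {m}) (s≤s z≤n) =
  cong suc (countTrue-below a a≤m)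

singleton : ∀ {m} → Fin m → Fin m → Bool
singleton i i′ = does (i′ Fin.≟ i)

countTrue-singleton : ∀ {m} (i : Fin m) → countTrue (singleton i) ≡ 1
countTrue-singleton {suc m} fzero =
  cong suc (countTrue-empty {m} (λ i → singleton fzero (fsuc i)) (λ i → dec-false (fsuc i Fin.≟ fzero) λ ()))
countTrue-singleton {suc m} (fsuc i) rewrite dec-false (fzero Fin.≟ fsuc i) (λ ()) = countTrue-singleton i

below-suc : ∀ {m} a (i : Fin m) → toℕ i ≡ a → ∀ i′ → (below a i′ ∨ singleton i i′) ≡ below (suc a) i′
below-suc a i i≡a i′ with toℕ i′ <? a
... | yes i′<a = trans (∨-trueˡ _ (below-true a i′ i′<a)) (sym (below-true (suc a) i′ (m<n⇒m<1+n i′<a)))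
... | no  i′≮a with i′ Fin.≟ i
...   | yes refl = trans (cong (_∨ true) (below-false a i′ i′≮a)) (sym (below-true (suc a) i′ (s≤s (≤-reflexive i≡a))))
...   | no  i′≢i = trans (cong (_∨ false) (below-false a i′ i′≮a)) (sym (below-false (suc a) i′ λ i′<1+a →
          i′≢i (Fin.toℕ-injective (≤-antisym (subst (toℕ i′ ≤_) (sym i≡a) (≤-pred i′<1+a))
                                              (subst (_≤ toℕ i′) (sym i≡a) (≮⇒≥ i′≮a))))))

countTrue-block : ∀ {m} a k (T : Fin m → Bool) → a + k ≤ m → Disjoint (below a) T →
                  (∀ i → (below a i ∨ T i) ≡ below (a + k) i) → countTrue T ≡ k
countTrue-block {m} a k T a+k≤m below#T extends = +-cancelˡ-≡ a _ _ (begin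
  a + countTrue T                      ≡⟨ cong (_+ countTrue T) (sym (countTrue-below {m} a (m+n≤o⇒m≤o a a+k≤m))) ⟩
  countTrue (below {m} a) + countTrue T ≡⟨ sym (countTrue-∨ (below a) T below#T) ⟩
  countTrue (λ i → below a i ∨ T i)    ≡⟨ countTrue-cong extends ⟩
  countTrue (below {m} (a + k))        ≡⟨ countTrue-below (a + k) a+k≤m ⟩
  a + k                                ∎)
  where open ≡-Reasoning

singleton-true : ∀ {m} (i : Fin m) {i′} → singleton i i′ ≡ true → i′ ≡ i
singleton-true i {i′} e = dec-true⁻¹ (i′ Fin.≟ i) e

singleton-disjoint : ∀ {m} (i : Fin m) {P : Fin m → Bool} → P i ≡ false → Disjoint P (singleton i)
singleton-disjoint i Pi≡false i′ Pi′ with i′ Fin.≟ i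
... | yes refl with () ← trans (sym Pi′) Pi≡false
... | no  _    = refl

-- Firing vertices at most once

receive : ∀ x y {t s} r → x + t ≡ suc (y + s) → (x + r) + t ≡ suc (y + (s + r))
receive x y {t} {s} r e = begin
  (x + r) + t     ≡⟨ xy∙z≈xz∙y x r t ⟩
  (x + t) + r     ≡⟨ cong (_+ r) e ⟩
  suc (y + s) + r ≡⟨ cong suc (+-assoc y s r) ⟩
  suc (y + (s + r)) ∎
  where open ≡-Reasoning

ind-step : ∀ (fired fires : Bool) {x K y s} → (fired ≡ true → fires ≡ false) → (fires ≡ true → K ≤ x) →
           x + (if fired then K else 0) ≡ suc (y + s) →
           (if fires then x ∸ K else x) + (if fired ∨ fires then K else 0) ≡ suc (y + s)
ind-step true  true  #  _   _ with () ← # refl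
ind-step true  false _  _   e = e
ind-step false true  _  K≤x e = trans (m∸n+n≡m (K≤x refl)) (trans (sym (+-identityʳ _)) e)
ind-step false false _  _   e = e

clq-step : ∀ (fired fires : Bool) {x p K y s} → (fired ≡ true → fires ≡ false) → (fires ≡ true → K ≤ x) →
           (fires ≡ true → 1 ≤ p) → x + (if fired then suc K else 0) ≡ suc (y + s) →
           (if fires then (x + (p ∸ 1)) ∸ K else x + p) + (if fired ∨ fires then suc K else 0) ≡ suc (y + (s + p))
clq-step true  true  #  _   _   _ with () ← # refl
clq-step true  false {x} {p} {y = y} _ _ _ e = receive x y p e
clq-step false false {x} {p} {y = y} _ _ _ e = receive x y p e
clq-step false true {p = zero} _ _ p≥1 _ with () ← p≥1 refl
clq-step false true {x} {suc p} {K} {y} {s} _ K≤x _ e = begin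
  (x + p ∸ K) + suc K   ≡⟨ +-suc _ K ⟩
  suc ((x + p ∸ K) + K) ≡⟨ cong suc (m∸n+n≡m (≤-trans (K≤x refl) (m≤m+n x p))) ⟩
  suc (x + p)           ≡⟨ cong (λ z → suc (z + p)) (trans (sym (+-identityʳ x)) e) ⟩
  suc (suc (y + s) + p) ≡⟨ cong suc (regroup y s p) ⟩
  suc (y + (s + suc p)) ∎
  where
  open ≡-Reasoning
  regroup : ∀ y s p → suc (y + s) + p ≡ y + (s + suc p)
  regroup = solve-∀

-- g is reached from c by firing the sink and then each vertex of Q and P exactly once.
-- A fired clique vertex is also counted among the senders on the right, hence suc (n + d);
-- the equations are additive to avoid truncated subtraction.
record Fired {n d} (c : Config n d) (Q : Fin d → Bool) (P : Fin n → Bool) (g : Config n d) : Set where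
  constructor fired
  field
    at-clq : ∀ i → cc g i + (if P i then suc (n + d) else 0) ≡ suc (cc c i + (countTrue Q + countTrue P))
    at-ind : ∀ j → ci g j + (if Q j then n + 1 else 0) ≡ suc (ci c j + countTrue P)
open Fired

module _ {n d : ℕ} {c : Config n d} where

  at-clq-fired : ∀ {Q P g} → Fired c Q P g → ∀ i → P i ≡ true →
                 cc g i + suc (n + d) ≡ suc (cc c i + (countTrue Q + countTrue P))
  at-clq-fired {Q} {P} {g} f i Pi =
    subst (λ b → cc g i + (if b then suc (n + d) else 0) ≡ suc (cc c i + (countTrue Q + countTrue P))) Pi (at-clq f i)

  at-clq-unfired : ∀ {Q P g} → Fired c Q P g → ∀ i → P i ≡ false → cc g i ≡ suc (cc c i + (countTrue Q + countTrue P))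
  at-clq-unfired {Q} {P} {g} f i Pi =
    trans (sym (+-identityʳ (cc g i)))
      (subst (λ b → cc g i + (if b then suc (n + d) else 0) ≡ suc (cc c i + (countTrue Q + countTrue P))) Pi (at-clq f i))

  at-ind-fired : ∀ {Q P g} → Fired c Q P g → ∀ j → Q j ≡ true → ci g j + (n + 1) ≡ suc (ci c j + countTrue P)
  at-ind-fired {Q} {P} {g} f j Qj =
    subst (λ b → ci g j + (if b then n + 1 else 0) ≡ suc (ci c j + countTrue P)) Qj (at-ind f j)

  at-ind-unfired : ∀ {Q P g} → Fired c Q P g → ∀ j → Q j ≡ false → ci g j ≡ suc (ci c j + countTrue P)
  at-ind-unfired {Q} {P} {g} f j Qj =
    trans (sym (+-identityʳ (ci g j)))
      (subst (λ b → ci g j + (if b then n + 1 else 0) ≡ suc (ci c j + countTrue P)) Qj (at-ind f j))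

  Fired-cong : ∀ {Q Q′ P P′ g} → (∀ j → Q j ≡ Q′ j) → (∀ i → P i ≡ P′ i) → Fired c Q P g → Fired c Q′ P′ g
  Fired-cong {Q} {Q′} {P} {P′} {g} Q≗Q′ P≗P′ (fired fc fi) = fired fc′ fi′
    where
    fc′ : ∀ i → cc g i + (if P′ i then suc (n + d) else 0) ≡ suc (cc c i + (countTrue Q′ + countTrue P′))
    fc′ i rewrite sym (P≗P′ i) | sym (countTrue-cong Q≗Q′) | sym (countTrue-cong P≗P′) = fc i
    fi′ : ∀ j → ci g j + (if Q′ j then n + 1 else 0) ≡ suc (ci c j + countTrue P′)
    fi′ j rewrite sym (Q≗Q′ j) | sym (countTrue-cong P≗P′) = fi j

  Fired-pointwise : ∀ {Q P g g′} → (∀ i → cc g i ≡ cc g′ i) → (∀ j → ci g j ≡ ci g′ j) → Fired c Q P g → Fired c Q P g′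
  Fired-pointwise same-clq same-ind (fired fc fi) =
    fired (λ i → subst (λ x → x + _ ≡ _) (same-clq i) (fc i)) (λ j → subst (λ x → x + _ ≡ _) (same-ind j) (fi j))

  Fired-sink : Fired c ∅ ∅ (topple c sink)
  Fired-sink = fired (λ i → cong suc (plus0 (cc c i) (countTrue-∅ {d}) (countTrue-∅ {n})))
                   (λ j → cong suc (trans (+-identityʳ _) (sym (trans (cong (ci c j +_) (countTrue-∅ {n})) (+-identityʳ _)))))
    where
    plus0 : ∀ x {a b} → a ≡ 0 → b ≡ 0 → x + 0 ≡ x + (a + b)
    plus0 x refl refl = refl

  Fired-toppleI : ∀ {Q P g} (T : Fin d → Bool) → Disjoint Q T → (∀ j → T j ≡ true → n + 1 ≤ ci g j) →
                  Fired c Q P g → Fired c (λ j → Q j ∨ T j) P (toppleI g T)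
  Fired-toppleI {Q} {P} {g} T Q#T unstable (fired fc fi) = fired fc′ fi′
    where
    fc′ : ∀ i → cc g i + countTrue T + (if P i then suc (n + d) else 0)
              ≡ suc (cc c i + (countTrue (λ j → Q j ∨ T j) + countTrue P))
    fc′ i rewrite countTrue-∨ Q T Q#T | xy∙z≈xz∙y (countTrue Q) (countTrue T) (countTrue P) =
      receive (cc g i) (cc c i) (countTrue T) (fc i)
    fi′ : ∀ j → (if T j then ci g j ∸ (n + 1) else ci g j) + (if Q j ∨ T j then n + 1 else 0)
              ≡ suc (ci c j + countTrue P)
    fi′ j = ind-step (Q j) (T j) {y = ci c j} (Q#T j) (unstable j) (fi j)

  Fired-toppleC : ∀ {Q P g} (T : Fin n → Bool) → Disjoint P T → (∀ i → T i ≡ true → n + d ≤ cc g i) →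
                  Fired c Q P g → Fired c Q (λ i → P i ∨ T i) (toppleC g T)
  Fired-toppleC {Q} {P} {g} T P#T unstable (fired fc fi) = fired fc′ fi′
    where
    fc′ : ∀ i → (if T i then (cc g i + (countTrue T ∸ 1)) ∸ (n + d) else cc g i + countTrue T)
                + (if P i ∨ T i then suc (n + d) else 0)
              ≡ suc (cc c i + (countTrue Q + countTrue (λ i → P i ∨ T i)))
    fc′ i rewrite countTrue-∨ P T P#T | sym (+-assoc (countTrue Q) (countTrue P) (countTrue T)) =
      clq-step (P i) (T i) {y = cc c i} (P#T i) (unstable i) (countTrue-positive T i) (fc i)
    fi′ : ∀ j → ci g j + countTrue T + (if Q j then n + 1 else 0) ≡ suc (ci c j + countTrue (λ i → P i ∨ T i))
    fi′ j rewrite countTrue-∨ P T P#T = receive (ci g j) (ci c j) (countTrue T) (fi j)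

  Fired-topple-clq : ∀ {Q P g} i → P i ≡ false → n + d ≤ cc g i →
                     Fired c Q P g → Fired c Q (λ i′ → P i′ ∨ singleton i i′) (topple g (clq i))
  Fired-topple-clq {g = g} i Pi≡false unstable f =
    Fired-pointwise same-clq same-ind
      (Fired-toppleC (singleton i) (singleton-disjoint i Pi≡false) unstable′ f)
    where
    unstable′ : ∀ i′ → singleton i i′ ≡ true → n + d ≤ cc g i′
    unstable′ i′ e with refl ← singleton-true i {i′} e = unstable
    same-clq : ∀ i′ → cc (toppleC g (singleton i)) i′ ≡ cc (topple g (clq i)) i′
    same-clq i′ rewrite countTrue-singleton i with singleton i i′
    ... | true  = cong (_∸ (n + d)) (+-identityʳ (cc g i′))
    ... | false = +-comm (cc g i′) 1
    same-ind : ∀ j → ci (toppleC g (singleton i)) j ≡ ci (topple g (clq i)) j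
    same-ind j rewrite countTrue-singleton i = +-comm (ci g j) 1

  Fired-topple-ind : ∀ {Q P g} j → Q j ≡ false → n + 1 ≤ ci g j →
                     Fired c Q P g → Fired c (λ j′ → Q j′ ∨ singleton j j′) P (topple g (ind j))
  Fired-topple-ind {g = g} j Qj≡false unstable f =
    Fired-pointwise same-clq (λ _ → refl)
      (Fired-toppleI (singleton j) (singleton-disjoint j Qj≡false) unstable′ f)
    where
    unstable′ : ∀ j′ → singleton j j′ ≡ true → n + 1 ≤ ci g j′
    unstable′ j′ e with refl ← singleton-true j {j′} e = unstable
    same-clq : ∀ i → cc (toppleI g (singleton j)) i ≡ cc (topple g (ind j)) i
    same-clq i rewrite countTrue-singleton j = +-comm (cc g i) 1

  unfired-clq-gains : ∀ {Q P g Q′ P′ g′} → Fired c Q P g → Fired c Q′ P′ g′ → Q ⊆ Q′ → P ⊆ P′ →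
                      ∀ i → P′ i ≡ false → cc g i ≤ cc g′ i
  unfired-clq-gains {Q} {P} {g} {Q′} {P′} {g′} f f′ Q⊆ P⊆ i P′i = begin
    cc g i                                      ≡⟨ at-clq-unfired f i (¬-not λ Pi → not-¬ (P⊆ i Pi) P′i) ⟩
    suc (cc c i + (countTrue Q + countTrue P))
      ≤⟨ s≤s (+-monoʳ-≤ (cc c i) (+-mono-≤ (countTrue-mono Q Q′ Q⊆) (countTrue-mono P P′ P⊆))) ⟩
    suc (cc c i + (countTrue Q′ + countTrue P′)) ≡⟨ sym (at-clq-unfired f′ i P′i) ⟩
    cc g′ i                                     ∎
    where open ≤-Reasoning

  unfired-ind-gains : ∀ {Q P g Q′ P′ g′} → Fired c Q P g → Fired c Q′ P′ g′ → Q ⊆ Q′ → P ⊆ P′ →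
                      ∀ j → Q′ j ≡ false → ci g j ≤ ci g′ j
  unfired-ind-gains {Q} {P} {g} {Q′} {P′} {g′} f f′ Q⊆ P⊆ j Q′j = begin
    ci g j                      ≡⟨ at-ind-unfired f j (¬-not λ Qj → not-¬ (Q⊆ j Qj) Q′j) ⟩
    suc (ci c j + countTrue P)  ≤⟨ s≤s (+-monoʳ-≤ (ci c j) (countTrue-mono P P′ P⊆)) ⟩
    suc (ci c j + countTrue P′) ≡⟨ sym (at-ind-unfired f′ j Q′j) ⟩
    ci g′ j                     ∎
    where open ≤-Reasoning

  module _ (stable : Stable c) where

    Fired⇒clq-stable : ∀ {Q P g} → Fired c Q P g → ∀ i → P i ≡ true → cc g i < n + d
    Fired⇒clq-stable {Q} {P} {g} f i Pi = +-cancelʳ-< (suc (n + d)) (cc g i) (n + d) (begin-strict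
      cc g i + suc (n + d)               ≡⟨ at-clq-fired f i Pi ⟩
      suc (cc c i + (countTrue Q + countTrue P)) ≤⟨ +-monoˡ-≤ _ (proj₁ stable i) ⟩
      (n + d) + (countTrue Q + countTrue P) ≡⟨ cong ((n + d) +_) (+-comm (countTrue Q) (countTrue P)) ⟩
      (n + d) + (countTrue P + countTrue Q) ≤⟨ +-monoʳ-≤ (n + d) (+-mono-≤ (countTrue≤ P) (countTrue≤ Q)) ⟩
      (n + d) + (n + d)                  <⟨ +-monoʳ-< (n + d) (n<1+n (n + d)) ⟩
      (n + d) + suc (n + d)              ∎)
      where open ≤-Reasoning

    Fired⇒ind-stable : ∀ {Q P g} → Fired c Q P g → ∀ j → Q j ≡ true → ci g j < n + 1
    Fired⇒ind-stable {Q} {P} {g} f j Qj = +-cancelʳ-< (n + 1) (ci g j) (n + 1) (begin-strict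
      ci g j + (n + 1)          ≡⟨ at-ind-fired f j Qj ⟩
      suc (ci c j) + countTrue P ≤⟨ +-monoˡ-≤ _ (proj₂ stable j) ⟩
      (n + 1) + countTrue P     <⟨ +-monoʳ-< (n + 1) (≤-trans (s≤s (countTrue≤ P)) (≤-reflexive (+-comm 1 n))) ⟩
      (n + 1) + (n + 1)         ∎)
      where open ≤-Reasoning

    Fired-all⇒stable : ∀ {Q P g} → Fired c Q P g → (∀ j → Q j ≡ true) → (∀ i → P i ≡ true) → Stable g
    Fired-all⇒stable {Q} {P} {g} f allQ allP =
      (λ i → subst (_< n + d) (sym (same-clq i)) (proj₁ stable i)) ,
      (λ j → subst (_< n + 1) (sym (same-ind j)) (proj₂ stable j))
      where
      open ≡-Reasoning
      same-clq : ∀ i → cc g i ≡ cc c i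
      same-clq i = +-cancelʳ-≡ (suc (n + d)) (cc g i) (cc c i) (begin
        cc g i + suc (n + d)                       ≡⟨ at-clq-fired f i (allP i) ⟩
        suc (cc c i + (countTrue Q + countTrue P))
          ≡⟨ cong (λ k → suc (cc c i + k)) (cong₂ _+_ (countTrue-full Q allQ) (countTrue-full P allP)) ⟩
        suc (cc c i + (d + n))                     ≡⟨ sym (+-suc (cc c i) (d + n)) ⟩
        cc c i + suc (d + n)                       ≡⟨ cong (λ k → cc c i + suc k) (+-comm d n) ⟩
        cc c i + suc (n + d)                       ∎)
      same-ind : ∀ j → ci g j ≡ ci c j
      same-ind j = +-cancelʳ-≡ (n + 1) (ci g j) (ci c j) (begin
        ci g j + (n + 1)           ≡⟨ at-ind-fired f j (allQ j) ⟩
        suc (ci c j + countTrue P) ≡⟨ cong (λ k → suc (ci c j + k)) (countTrue-full P allP) ⟩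
        suc (ci c j + n)           ≡⟨ +-comm 1 (ci c j + n) ⟩
        ci c j + n + 1             ≡⟨ +-assoc (ci c j) n 1 ⟩
        ci c j + (n + 1)           ∎)

    Fired-afterQ : ∀ {Q P g} → Fired c Q P g →
                   Fired c (λ j → Q j ∨ QSet g j) P (afterQ g) × Disjoint Q (QSet g)
    Fired-afterQ {Q} {P} {g} f =
      Fired-toppleI (QSet g) Q#QSet (λ j → dec-true⁻¹ (n + 1 ≤? ci g j)) f , Q#QSet
      where
      Q#QSet : Disjoint Q (QSet g)
      Q#QSet j Qj = dec-false (n + 1 ≤? ci g j) (<⇒≱ (Fired⇒ind-stable f j Qj))

    Fired-toppleC-PSet : ∀ {Q P g} → Fired c Q P g →
                         Fired c Q (λ i → P i ∨ PSet g i) (toppleC g (PSet g)) × Disjoint P (PSet g)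
    Fired-toppleC-PSet {Q} {P} {g} f =
      Fired-toppleC (PSet g) P#PSet (λ i → dec-true⁻¹ (n + d ≤? cc g i)) f , P#PSet
      where
      P#PSet : Disjoint P (PSet g)
      P#PSet i Pi = dec-false (n + d ≤? cc g i) (<⇒≱ (Fired⇒clq-stable f i Pi))

-- Soundness

data WellShaped : List ℕ → List ℕ → Set where
  last : ∀ {q p} → 1 ≤ p ⊎ 1 ≤ q → WellShaped (q ∷ []) (p ∷ [])
  cons : ∀ {q p qs ps} → 1 ≤ p → WellShaped qs ps → WellShaped (q ∷ qs) (p ∷ ps)

record Outcome {n d} (c : Config n d) (Q : Fin d → Bool) (P : Fin n → Bool) (qs ps : List ℕ) : Set where
  field
    Q* : Fin d → Bool
    P* : Fin n → Bool
    final : Config n d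
    final-fired : Fired c Q* P* final
    final-stable : Stable final
    count-Q : sum qs + countTrue Q ≡ countTrue Q*
    count-P : sum ps + countTrue P ≡ countTrue P*

count-shift : ∀ q a {s b t} → b ≡ a + q → s + b ≡ t → (q + s) + a ≡ t
count-shift q a {s} refl refl = shuffle q s a
  where
  shuffle : ∀ q s a → (q + s) + a ≡ s + (a + q)
  shuffle = solve-∀

FiredIn : ∀ {n d} → (Fin d → Bool) → (Fin n → Bool) → Vertex n d → Set
FiredIn Q P sink    = ⊤
FiredIn Q P (clq i) = P i ≡ true
FiredIn Q P (ind j) = Q j ≡ true

idle-round⇒stable : ∀ {n d} (g : Config n d) → countTrue (QSet g) ≡ 0 → countTrue (PSet (afterQ g)) ≡ 0 →
                    Stable (afterQP g) → Stable g
idle-round⇒stable {n} {d} g noQ noP (stable-clq , stable-ind) =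
  (λ i → subst (_< n + d) (same-clq i) (stable-clq i)) , (λ j → subst (_< n + 1) (same-ind j) (stable-ind j))
  where
  same-clq : ∀ i → cc (afterQP g) i ≡ cc g i
  same-clq i rewrite countTrue≡0⇒false (PSet (afterQ g)) noP i | noP | noQ = trans (+-identityʳ _) (+-identityʳ _)
  same-ind : ∀ j → ci (afterQP g) j ≡ ci g j
  same-ind j rewrite countTrue≡0⇒false (QSet g) noQ j | noP = +-identityʳ _

module _ {n d : ℕ} {c : Config n d} (stable : Stable c) where

  ITCRun-outcome : ∀ {Q P g qs ps} → Fired c Q P g → ITCRun g qs ps → Outcome c Q P qs ps
  ITCRun-outcome {Q} {P} {g} f (stop st) =
    let fQ , Q#QSet = Fired-afterQ stable f
        fP , P#PSet = Fired-toppleC-PSet stable fQ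
    in record { final = afterQP g ; final-fired = fP ; final-stable = st
              ; count-Q = count-shift _ (countTrue Q) (countTrue-∨ Q (QSet g) Q#QSet) refl
              ; count-P = count-shift _ (countTrue P) (countTrue-∨ P (PSet (afterQ g)) P#PSet) refl }
  ITCRun-outcome {Q} {P} {g} f (next _ run) =
    let fQ , Q#QSet = Fired-afterQ stable f
        fP , P#PSet = Fired-toppleC-PSet stable fQ
        o = ITCRun-outcome fP run
        open Outcome o
    in record { final = final ; final-fired = final-fired ; final-stable = final-stable
              ; count-Q = count-shift _ (countTrue Q) (countTrue-∨ Q (QSet g) Q#QSet) count-Q
              ; count-P = count-shift _ (countTrue P) (countTrue-∨ P (PSet (afterQ g)) P#PSet) count-P }

  -- A toppled vertex was unstable, so it had not fired yet (Fired⇒…-stable) and, since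
  -- unfired vertices only gain grains, it would still be unstable in f had it not fired.
  legal⇒fired : ∀ {Q* P* f} → Fired c Q* P* f → Stable f →
                ∀ {Q P g} us → Fired c Q P g → Q ⊆ Q* → P ⊆ P* → LegalFrom g us → All (FiredIn Q* P*) us
  legal⇒fired ff sf [] _ _ _ _ = []
  legal⇒fired ff sf (sink ∷ us) _ _ _ (() , _)
  legal⇒fired {Q*} {P*} {f} ff sf {Q} {P} {g} (clq i ∷ us) fg Q⊆ P⊆ (unstable , legal) =
    P*i ∷ legal⇒fired ff sf us (Fired-topple-clq i Pi≡false unstable fg) Q⊆ P⊆′ legal
    where
    Pi≡false : P i ≡ false
    Pi≡false = ¬-not λ Pi → <⇒≱ (Fired⇒clq-stable stable fg i Pi) unstable
    P*i : P* i ≡ true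
    P*i = ¬-not λ P*i≡false → <⇒≱ (proj₁ sf i) (≤-trans unstable (unfired-clq-gains fg ff Q⊆ P⊆ i P*i≡false))
    P⊆′ : (λ i′ → P i′ ∨ singleton i i′) ⊆ P*
    P⊆′ i′ e with ∨-true⁻ (P i′) (singleton i i′) e
    ... | inj₁ Pi′ = P⊆ i′ Pi′
    ... | inj₂ i′≡i with refl ← singleton-true i {i′} i′≡i = P*i
  legal⇒fired {Q*} {P*} {f} ff sf {Q} {P} {g} (ind j ∷ us) fg Q⊆ P⊆ (unstable , legal) =
    Q*j ∷ legal⇒fired ff sf us (Fired-topple-ind j Qj≡false unstable fg) Q⊆′ P⊆ legal
    where
    Qj≡false : Q j ≡ false
    Qj≡false = ¬-not λ Qj → <⇒≱ (Fired⇒ind-stable stable fg j Qj) unstable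
    Q*j : Q* j ≡ true
    Q*j = ¬-not λ Q*j≡false → <⇒≱ (proj₂ sf j) (≤-trans unstable (unfired-ind-gains fg ff Q⊆ P⊆ j Q*j≡false))
    Q⊆′ : (λ j′ → Q j′ ∨ singleton j j′) ⊆ Q*
    Q⊆′ j′ e with ∨-true⁻ (Q j′) (singleton j j′) e
    ... | inj₁ Qj′ = Q⊆ j′ Qj′
    ... | inj₂ j′≡j with refl ← singleton-true j {j′} j′≡j = Q*j

  recurrent⇒all-fire : ∀ {qs ps} us → (∀ v → v ∈ sink ∷ us) → LegalFrom (topple c sink) us →
                       ITCRun (topple c sink) qs ps → sum qs ≡ d × sum ps ≡ n
  recurrent⇒all-fire {qs} {ps} us covers legal run =
    total count-Q (countTrue-full Q* Q*-full) , total count-P (countTrue-full P* P*-full)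
    where
    open Outcome (ITCRun-outcome Fired-sink run)
    all-fired : All (FiredIn Q* P*) us
    all-fired = legal⇒fired final-fired final-stable us Fired-sink (λ _ ()) (λ _ ()) legal
    Q*-full : ∀ j → Q* j ≡ true
    Q*-full j with covers (ind j)
    ... | there j∈us = All.lookup all-fired j∈us
    P*-full : ∀ i → P* i ≡ true
    P*-full i with covers (clq i)
    ... | there i∈us = All.lookup all-fired i∈us
    total : ∀ {m s t} → s + countTrue (∅ {m}) ≡ t → t ≡ m → s ≡ m
    total {m} {s} e t≡m = trans (sym (trans (cong (s +_) (countTrue-∅ {m})) (+-identityʳ s))) (trans e t≡m)

  afterQ-ind-stable : ∀ {Q P g} → Fired c Q P g → ∀ j → ci (afterQ g) j < n + 1
  afterQ-ind-stable {Q} {g = g} f j with QSet g j in e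
  ... | true  = subst (_< n + 1) (if-true e) (Fired⇒ind-stable stable (proj₁ (Fired-afterQ stable f)) j (∨-trueʳ (Q j) e))
  ... | false = ≰⇒> (dec-false⁻¹ (n + 1 ≤? ci g j) e)

  stable-without-PSet : ∀ {Q P g} → Fired c Q P g → countTrue (PSet (afterQ g)) ≡ 0 → Stable (afterQP g)
  stable-without-PSet {g = g} f none = at-clq′ , at-ind′
    where
    at-clq′ : ∀ i → cc (afterQP g) i < n + d
    at-clq′ i rewrite countTrue≡0⇒false (PSet (afterQ g)) none i | none =
      subst (_< n + d) (sym (+-identityʳ _))
        (≰⇒> (dec-false⁻¹ (n + d ≤? cc (afterQ g) i) (countTrue≡0⇒false (PSet (afterQ g)) none i)))
    at-ind′ : ∀ j → ci (afterQP g) j < n + 1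
    at-ind′ j rewrite none = subst (_< n + 1) (sym (+-identityʳ _)) (afterQ-ind-stable f j)

  PSet-nonempty : ∀ {Q P g} → Fired c Q P g → ¬ Stable (afterQP g) → 1 ≤ countTrue (PSet (afterQ g))
  PSet-nonempty f unstable = n≢0⇒n>0 λ none → unstable (stable-without-PSet f none)

  ITCRun-wellShaped : ∀ {Q P g qs ps} → Fired c Q P g → ¬ Stable g ⊎ 1 ≤ sum ps → ITCRun g qs ps → WellShaped qs ps
  ITCRun-wellShaped f (inj₂ p≥1) (stop _) = last (inj₁ (subst (1 ≤_) (+-identityʳ _) p≥1))
  ITCRun-wellShaped {g = g} f (inj₁ unstable) (stop st) = last topples
    where
    topples : 1 ≤ countTrue (PSet (afterQ g)) ⊎ 1 ≤ countTrue (QSet g)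
    topples with countTrue (PSet (afterQ g)) ≟ 0 | countTrue (QSet g) ≟ 0
    ... | no  someP | _        = inj₁ (n≢0⇒n>0 someP)
    ... | yes _     | no someQ = inj₂ (n≢0⇒n>0 someQ)
    ... | yes noP   | yes noQ  = ⊥-elim (unstable (idle-round⇒stable g noQ noP st))
  ITCRun-wellShaped f _ (next unstable run) =
    cons (PSet-nonempty f unstable)
         (ITCRun-wellShaped (proj₁ (Fired-toppleC-PSet stable (proj₁ (Fired-afterQ stable f)))) (inj₁ unstable) run)

ITCRun-sound : ∀ {n d} {c : Config n d} {qs ps} → 1 ≤ n → SortedRec c → ITCRun (topple c sink) qs ps →
               WellShaped qs ps × sum qs ≡ d × sum ps ≡ n
ITCRun-sound 1≤n ((stable , us , _ , covers , legal) , _) run =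
  let all-Q , all-P = recurrent⇒all-fire stable us covers legal run
  in ITCRun-wellShaped stable Fired-sink (inj₂ (subst (1 ≤_) (sym all-P) 1≤n)) run , all-Q , all-P

-- Completeness

∸-<-split : ∀ {x} a {s} → ¬ x < a → x < a + s → x ∸ a < s
∸-<-split {x} a {s} x≮a x<a+s = subst (x ∸ a <_) (m+n∸m≡n a s) (∸-monoˡ-< x<a+s (≮⇒≥ x≮a))

∸-<⇒< : ∀ {x} a {s} → a ≤ x → x ∸ a < s → x < a + s
∸-<⇒< {x} a {s} a≤x x∸a<s = subst (_< a + s) (trans (+-comm a _) (m∸n+n≡m a≤x)) (+-monoʳ-< a x∸a<s)

+suc≡⇒< : ∀ {a m k} → a + suc m ≡ k → a < k
+suc≡⇒< {a} {m} e = subst (a <_) e (≤-trans (m≤m+n (suc a) m) (≤-reflexive (sym (+-suc a m))))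

level⇒≥ : ∀ {x s K t} → x + s ≡ K + t → s ≤ t → K ≤ x
level⇒≥ {x} {s} {K} {t} e s≤t = +-cancelʳ-≤ s K x (begin
  K + s ≤⟨ +-monoʳ-≤ K s≤t ⟩
  K + t ≡⟨ sym e ⟩
  x + s ∎)
  where open ≤-Reasoning

level⇒< : ∀ {x s K t} → x + s ≡ K + t → t < s → x < K
level⇒< {x} {s} {K} {t} e t<s = +-cancelʳ-< s x K (begin-strict
  x + s ≡⟨ e ⟩
  K + t <⟨ +-monoʳ-< K t<s ⟩
  K + s ∎)
  where open ≤-Reasoning

-- The grains a clique (independent) vertex with the given index receives from non-sink
-- vertices before it fires, other than from its own block, when each part fires in
-- blocks of consecutive indices of sizes ps (qs), the rounds alternating q₁ p₁ q₂ p₂ ….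
inflowC : List ℕ → List ℕ → ℕ → ℕ
inflowC (q ∷ qs) (p ∷ ps) i = if does (i <? p) then q else p + q + inflowC qs ps (i ∸ p)
inflowC _        _        _ = 0

inflowI : List ℕ → List ℕ → ℕ → ℕ
inflowI (q ∷ qs) (p ∷ ps) j = if does (j <? q) then 0 else p + inflowI qs ps (j ∸ q)
inflowI _        _        _ = 0

module _ (q p : ℕ) (qs ps : List ℕ) where

  inflowC-here : ∀ i → i < p → inflowC (q ∷ qs) (p ∷ ps) i ≡ q
  inflowC-here i i<p = if-true (dec-true (i <? p) i<p)

  inflowC-later : ∀ i → ¬ i < p → inflowC (q ∷ qs) (p ∷ ps) i ≡ p + q + inflowC qs ps (i ∸ p)
  inflowC-later i i≮p = if-false (dec-false (i <? p) i≮p)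

  inflowI-here : ∀ j → j < q → inflowI (q ∷ qs) (p ∷ ps) j ≡ 0
  inflowI-here j j<q = if-true (dec-true (j <? q) j<q)

  inflowI-later : ∀ j → ¬ j < q → inflowI (q ∷ qs) (p ∷ ps) j ≡ p + inflowI qs ps (j ∸ q)
  inflowI-later j j≮q = if-false (dec-false (j <? q) j≮q)

inflowC-mono : ∀ qs ps {i i′} → i ≤ i′ → inflowC qs ps i ≤ inflowC qs ps i′
inflowC-mono (q ∷ qs) (p ∷ ps) {i} {i′} i≤i′ with i <? p | i′ <? p
... | yes i<p | yes i′<p rewrite inflowC-here q p qs ps i i<p | inflowC-here q p qs ps i′ i′<p = ≤-refl
... | yes i<p | no  i′≮p rewrite inflowC-here q p qs ps i i<p | inflowC-later q p qs ps i′ i′≮p =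
  ≤-trans (m≤n+m q p) (m≤m+n (p + q) _)
... | no  i≮p | yes i′<p = contradiction (≤-<-trans i≤i′ i′<p) i≮p
... | no  i≮p | no  i′≮p rewrite inflowC-later q p qs ps i i≮p | inflowC-later q p qs ps i′ i′≮p =
  +-monoʳ-≤ (p + q) (inflowC-mono qs ps (∸-monoˡ-≤ p i≤i′))
inflowC-mono []       _  _ = z≤n
inflowC-mono (_ ∷ _)  [] _ = z≤n

inflowI-mono : ∀ qs ps {j j′} → j ≤ j′ → inflowI qs ps j ≤ inflowI qs ps j′
inflowI-mono (q ∷ qs) (p ∷ ps) {j} {j′} j≤j′ with j <? q | j′ <? q
... | yes j<q | yes j′<q rewrite inflowI-here q p qs ps j j<q | inflowI-here q p qs ps j′ j′<q = ≤-refl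
... | yes j<q | no  j′≮q rewrite inflowI-here q p qs ps j j<q | inflowI-later q p qs ps j′ j′≮q = z≤n
... | no  j≮q | yes j′<q = contradiction (≤-<-trans j≤j′ j′<q) j≮q
... | no  j≮q | no  j′≮q rewrite inflowI-later q p qs ps j j≮q | inflowI-later q p qs ps j′ j′≮q =
  +-monoʳ-≤ p (inflowI-mono qs ps (∸-monoˡ-≤ q j≤j′))
inflowI-mono []       _  _ = z≤n
inflowI-mono (_ ∷ _)  [] _ = z≤n

inflowC-bound : ∀ qs ps i → i < sum ps → inflowC qs ps i < sum qs + sum ps
inflowC-bound (q ∷ qs) (p ∷ ps) i i<Σ with i <? p
... | yes i<p rewrite inflowC-here q p qs ps i i<p = begin-strict
  q                        ≤⟨ m≤m+n q (sum qs) ⟩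
  q + sum qs               <⟨ m<m+n (q + sum qs) (≤-trans (s≤s z≤n) i<p) ⟩
  q + sum qs + p           ≤⟨ +-monoʳ-≤ (q + sum qs) (m≤m+n p (sum ps)) ⟩
  q + sum qs + (p + sum ps) ∎
  where open ≤-Reasoning
... | no  i≮p rewrite inflowC-later q p qs ps i i≮p = begin-strict
  p + q + inflowC qs ps (i ∸ p) <⟨ +-monoʳ-< (p + q) (inflowC-bound qs ps (i ∸ p) (∸-<-split p i≮p i<Σ)) ⟩
  p + q + (sum qs + sum ps)     ≡⟨ regroup p q (sum qs) (sum ps) ⟩
  q + sum qs + (p + sum ps)     ∎
  where
  open ≤-Reasoning
  regroup : ∀ p q a b → p + q + (a + b) ≡ q + a + (p + b)
  regroup = solve-∀
inflowC-bound []      ps i i<Σ = ≤-<-trans z≤n i<Σ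
inflowC-bound (_ ∷ _) [] i ()

inflowI-bound : ∀ qs ps j → j < sum qs → inflowI qs ps j ≤ sum ps
inflowI-bound (q ∷ qs) (p ∷ ps) j j<Σ with j <? q
... | yes j<q rewrite inflowI-here q p qs ps j j<q = z≤n
... | no  j≮q rewrite inflowI-later q p qs ps j j≮q =
  +-monoʳ-≤ p (inflowI-bound qs ps (j ∸ q) (∸-<-split q j≮q j<Σ))
inflowI-bound (_ ∷ _) [] j _ = z≤n

inflowC-after-block : ∀ {q p qs ps} → WellShaped (q ∷ qs) (p ∷ ps) →
                      ∀ i → i < p + sum ps → ¬ i < p → q < inflowC (q ∷ qs) (p ∷ ps) i
inflowC-after-block (last _) i i<Σ i≮p = contradiction (subst (i <_) (+-identityʳ _) i<Σ) i≮p
inflowC-after-block {q} {p} {qs} {ps} (cons 1≤p _) i _ i≮p rewrite inflowC-later q p qs ps i i≮p =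
  ≤-trans (+-monoˡ-≤ q 1≤p) (m≤m+n (p + q) _)

inflowI-after-block : ∀ {q p qs ps} → WellShaped (q ∷ qs) (p ∷ ps) →
                      ∀ j → j < q + sum qs → ¬ j < q → 1 ≤ inflowI (q ∷ qs) (p ∷ ps) j
inflowI-after-block (last _) j j<Σ j≮q = contradiction (subst (j <_) (+-identityʳ _) j<Σ) j≮q
inflowI-after-block {q} {p} {qs} {ps} (cons 1≤p _) j _ j≮q rewrite inflowI-later q p qs ps j j≮q =
  ≤-trans 1≤p (m≤m+n p _)

-- indAt and clqAt return the sink outside their range; this junk value is never reached.
module _ {n d : ℕ} where

  indAt : ℕ → Vertex n d
  indAt a with a <? d
  ... | yes a<d = ind (fromℕ< a<d)
  ... | no  _   = sink

  clqAt : ℕ → Vertex n d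
  clqAt b with b <? n
  ... | yes b<n = clq (fromℕ< b<n)
  ... | no  _   = sink

  indAt-ind : ∀ a → a < d → Σ (Fin d) λ j → indAt a ≡ ind j × toℕ j ≡ a
  indAt-ind a a<d with a <? d
  ... | yes a<d′ = fromℕ< a<d′ , refl , Fin.toℕ-fromℕ< a<d′
  ... | no  a≮d  = contradiction a<d a≮d

  clqAt-clq : ∀ b → b < n → Σ (Fin n) λ i → clqAt b ≡ clq i × toℕ i ≡ b
  clqAt-clq b b<n with b <? n
  ... | yes b<n′ = fromℕ< b<n′ , refl , Fin.toℕ-fromℕ< b<n′
  ... | no  b≮n  = contradiction b<n b≮n

  indRange : ℕ → ℕ → List (Vertex n d)
  indRange a zero    = []
  indRange a (suc m) = indAt a ∷ indRange (suc a) m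

  clqRange : ℕ → ℕ → List (Vertex n d)
  clqRange b zero    = []
  clqRange b (suc m) = clqAt b ∷ clqRange (suc b) m

  itcOrder : ℕ → ℕ → List ℕ → List ℕ → List (Vertex n d)
  itcOrder A B (q ∷ qs) (p ∷ ps) = indRange A q ++ (clqRange B p ++ itcOrder (A + q) (B + p) qs ps)
  itcOrder A B _        _        = []

  Beyond : ℕ → ℕ → Vertex n d → Set
  Beyond a b sink    = ⊥
  Beyond a b (ind j) = a ≤ toℕ j
  Beyond a b (clq i) = b ≤ toℕ i

  Beyond-weaken : ∀ {a a′ b b′} → a′ ≤ a → b′ ≤ b → ∀ {v} → Beyond a b v → Beyond a′ b′ v
  Beyond-weaken a′≤a _    {ind j} a≤j = ≤-trans a′≤a a≤j
  Beyond-weaken _    b′≤b {clq i} b≤i = ≤-trans b′≤b b≤i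

  indRange-unique : ∀ m a b (rest : List (Vertex n d)) → a + m ≤ d → All (Beyond (a + m) b) rest → Unique rest →
                    Unique (indRange a m ++ rest) × All (Beyond a b) (indRange a m ++ rest)
  indRange-unique zero a b rest _ beyond unique = unique , subst (λ k → All (Beyond k b) rest) (+-identityʳ a) beyond
  indRange-unique (suc m) a b rest a+m<d beyond unique with indAt-ind a (≤-trans (+suc≡⇒< refl) a+m<d)
  ... | j , e , j≡a rewrite e =
    let unique′ , beyond′ = indRange-unique m (suc a) b rest (subst (_≤ d) (+-suc a m) a+m<d)
                              (subst (λ k → All (Beyond k b) rest) (+-suc a m) beyond) unique
    in All.map (λ {v} → fresh v) beyond′ ∷ unique′
     , ≤-reflexive (sym j≡a) ∷ All.map (Beyond-weaken (n≤1+n a) ≤-refl) beyond′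
    where
    fresh : ∀ v → Beyond (suc a) b v → ind j ≢ v
    fresh (ind _) a<j refl = <-irrefl (sym j≡a) a<j

  clqRange-unique : ∀ m a b (rest : List (Vertex n d)) → b + m ≤ n → All (Beyond a (b + m)) rest → Unique rest →
                    Unique (clqRange b m ++ rest) × All (Beyond a b) (clqRange b m ++ rest)
  clqRange-unique zero a b rest _ beyond unique = unique , subst (λ k → All (Beyond a k) rest) (+-identityʳ b) beyond
  clqRange-unique (suc m) a b rest b+m<n beyond unique with clqAt-clq b (≤-trans (+suc≡⇒< refl) b+m<n)
  ... | i , e , i≡b rewrite e =
    let unique′ , beyond′ = clqRange-unique m a (suc b) rest (subst (_≤ n) (+-suc b m) b+m<n)
                              (subst (λ k → All (Beyond a k) rest) (+-suc b m) beyond) unique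
    in All.map (λ {v} → fresh v) beyond′ ∷ unique′
     , ≤-reflexive (sym i≡b) ∷ All.map (Beyond-weaken ≤-refl (n≤1+n b)) beyond′
    where
    fresh : ∀ v → Beyond a (suc b) v → clq i ≢ v
    fresh (clq _) b<i refl = <-irrefl (sym i≡b) b<i

  itcOrder-unique : ∀ qs ps A B → A + sum qs ≤ d → B + sum ps ≤ n →
                    Unique (itcOrder A B qs ps) × All (Beyond A B) (itcOrder A B qs ps)
  itcOrder-unique (q ∷ qs) (p ∷ ps) A B ΣA≤d ΣB≤n =
    let A+q+Σ≤d = subst (_≤ d) (sym (+-assoc A q (sum qs))) ΣA≤d
        B+p+Σ≤n = subst (_≤ n) (sym (+-assoc B p (sum ps))) ΣB≤n
        u₁ , b₁ = itcOrder-unique qs ps (A + q) (B + p) A+q+Σ≤d B+p+Σ≤n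
        u₂ , b₂ = clqRange-unique p (A + q) B _ (m+n≤o⇒m≤o (B + p) B+p+Σ≤n) b₁ u₁
    in indRange-unique q A B _ (m+n≤o⇒m≤o (A + q) A+q+Σ≤d) b₂ u₂
  itcOrder-unique []      _  A B _ _ = [] , []
  itcOrder-unique (_ ∷ _) [] A B _ _ = [] , []

  ∈-indRange : ∀ m a (j : Fin d) → a ≤ toℕ j → toℕ j < a + m → ind j ∈ indRange a m
  ∈-indRange zero    a j a≤j j<a+0 = contradiction (subst (toℕ j <_) (+-identityʳ a) j<a+0) (≤⇒≯ a≤j)
  ∈-indRange (suc m) a j a≤j j<a+m with toℕ j ≟ a
  ... | yes j≡a with indAt-ind a (subst (_< d) j≡a (Fin.toℕ<n j))
  ...   | j′ , e , j′≡a = here (sym (trans e (cong ind (Fin.toℕ-injective (trans j′≡a (sym j≡a))))))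
  ∈-indRange (suc m) a j a≤j j<a+m | no j≢a =
    there (∈-indRange m (suc a) j (≤∧≢⇒< a≤j (λ a≡j → j≢a (sym a≡j))) (subst (toℕ j <_) (+-suc a m) j<a+m))

  ∈-clqRange : ∀ m b (i : Fin n) → b ≤ toℕ i → toℕ i < b + m → clq i ∈ clqRange b m
  ∈-clqRange zero    b i b≤i i<b+0 = contradiction (subst (toℕ i <_) (+-identityʳ b) i<b+0) (≤⇒≯ b≤i)
  ∈-clqRange (suc m) b i b≤i i<b+m with toℕ i ≟ b
  ... | yes i≡b with clqAt-clq b (subst (_< n) i≡b (Fin.toℕ<n i))
  ...   | i′ , e , i′≡b = here (sym (trans e (cong clq (Fin.toℕ-injective (trans i′≡b (sym i≡b))))))
  ∈-clqRange (suc m) b i b≤i i<b+m | no i≢b =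
    there (∈-clqRange m (suc b) i (≤∧≢⇒< b≤i (λ b≡i → i≢b (sym b≡i))) (subst (toℕ i <_) (+-suc b m) i<b+m))

  ind∈itcOrder : ∀ {qs ps} → WellShaped qs ps → ∀ A B → A + sum qs ≡ d →
                 ∀ j → A ≤ toℕ j → ind j ∈ itcOrder A B qs ps
  ind∈itcOrder {q ∷ qs} {p ∷ ps} shape A B ΣA j A≤j with toℕ j <? A + q
  ... | yes j<A+q = ∈-++⁺ˡ (∈-indRange q A j A≤j j<A+q)
  ... | no  j≮A+q = ∈-++⁺ʳ (indRange A q) (∈-++⁺ʳ (clqRange B p) (later shape))
    where
    later : WellShaped (q ∷ qs) (p ∷ ps) → ind j ∈ itcOrder (A + q) (B + p) qs ps
    later (last _) = contradiction (subst (toℕ j <_) (trans (sym ΣA) (cong (A +_) (+-identityʳ q))) (Fin.toℕ<n j)) j≮A+q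
    later (cons _ shape′) = ind∈itcOrder shape′ (A + q) (B + p) (trans (+-assoc A q (sum qs)) ΣA) j (≮⇒≥ j≮A+q)

  clq∈itcOrder : ∀ {qs ps} → WellShaped qs ps → ∀ A B → B + sum ps ≡ n →
                 ∀ i → B ≤ toℕ i → clq i ∈ itcOrder A B qs ps
  clq∈itcOrder {q ∷ qs} {p ∷ ps} shape A B ΣB i B≤i with toℕ i <? B + p
  ... | yes i<B+p = ∈-++⁺ʳ (indRange A q) (∈-++⁺ˡ (∈-clqRange p B i B≤i i<B+p))
  ... | no  i≮B+p = ∈-++⁺ʳ (indRange A q) (∈-++⁺ʳ (clqRange B p) (later shape))
    where
    later : WellShaped (q ∷ qs) (p ∷ ps) → clq i ∈ itcOrder (A + q) (B + p) qs ps
    later (last _) = contradiction (subst (toℕ i <_) (trans (sym ΣB) (cong (B +_) (+-identityʳ p))) (Fin.toℕ<n i)) i≮B+p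
    later (cons _ shape′) = clq∈itcOrder shape′ (A + q) (B + p) (trans (+-assoc B p (sum ps)) ΣB) i (≮⇒≥ i≮B+p)

module Realisation {n d : ℕ} (c : Config n d) (stable : Stable c) where

  -- Once the first A independent and the first B clique vertices have fired, each
  -- remaining vertex is short of instability by exactly its inflow from the rounds qs, ps.
  CalibratedC : ℕ → ℕ → List ℕ → List ℕ → Set
  CalibratedC A B qs ps = ∀ i → B ≤ toℕ i → suc (cc c i + (A + B + inflowC qs ps (toℕ i ∸ B))) ≡ n + d

  CalibratedI : ℕ → ℕ → List ℕ → List ℕ → Set
  CalibratedI A B qs ps = ∀ j → A ≤ toℕ j → ci c j + (B + inflowI qs ps (toℕ j ∸ A)) ≡ n

  CalibratedC-next : ∀ {A B q p qs ps} → CalibratedC A B (q ∷ qs) (p ∷ ps) → CalibratedC (A + q) (B + p) qs ps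
  CalibratedC-next {A} {B} {q} {p} {qs} {ps} cal i B+p≤i =
    trans (cong (λ k → suc (cc c i + k)) shift) (cal i (m+n≤o⇒m≤o B B+p≤i))
    where
    i≮B+p : ¬ (toℕ i ∸ B < p)
    i≮B+p lt = <⇒≱ lt (m+n≤o⇒m≤o∸n p (subst (_≤ toℕ i) (+-comm B p) B+p≤i))
    regroup : ∀ A B q p t → (A + q) + (B + p) + t ≡ A + B + (p + q + t)
    regroup = solve-∀
    shift : (A + q) + (B + p) + inflowC qs ps (toℕ i ∸ (B + p)) ≡ A + B + inflowC (q ∷ qs) (p ∷ ps) (toℕ i ∸ B)
    shift rewrite inflowC-later q p qs ps (toℕ i ∸ B) i≮B+p | ∸-+-assoc (toℕ i) B p = regroup A B q p _

  CalibratedI-next : ∀ {A B q p qs ps} → CalibratedI A B (q ∷ qs) (p ∷ ps) → CalibratedI (A + q) (B + p) qs ps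
  CalibratedI-next {A} {B} {q} {p} {qs} {ps} cal j A+q≤j =
    trans (cong (ci c j +_) shift) (cal j (m+n≤o⇒m≤o A A+q≤j))
    where
    j≮A+q : ¬ (toℕ j ∸ A < q)
    j≮A+q lt = <⇒≱ lt (m+n≤o⇒m≤o∸n q (subst (_≤ toℕ j) (+-comm A q) A+q≤j))
    shift : (B + p) + inflowI qs ps (toℕ j ∸ (A + q)) ≡ B + inflowI (q ∷ qs) (p ∷ ps) (toℕ j ∸ A)
    shift rewrite inflowI-later q p qs ps (toℕ j ∸ A) j≮A+q | ∸-+-assoc (toℕ j) A q = +-assoc B p _

  clq-level : ∀ {A B qs ps a b g} → Fired c (below a) (below b) g → CalibratedC A B qs ps → a ≤ d → b ≤ n →
              ∀ i → B ≤ toℕ i → ¬ toℕ i < b →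
              cc g i + (A + B + inflowC qs ps (toℕ i ∸ B)) ≡ (n + d) + (a + b)
  clq-level {A} {B} {qs} {ps} {a} {b} {g} f cal a≤d b≤n i B≤i i≮b = begin
    cc g i + s                                                   ≡⟨ cong (_+ s) (at-clq-unfired f i (below-false b i i≮b)) ⟩
    suc (cc c i + (countTrue (below {d} a) + countTrue (below {n} b))) + s
      ≡⟨ cong (λ k → suc (cc c i + k) + s) (cong₂ _+_ (countTrue-below a a≤d) (countTrue-below b b≤n)) ⟩
    suc (cc c i) + (a + b) + s                                   ≡⟨ xy∙z≈xz∙y (suc (cc c i)) (a + b) s ⟩
    suc (cc c i) + s + (a + b)                                   ≡⟨ cong (_+ (a + b)) (cal i B≤i) ⟩
    (n + d) + (a + b)                                            ∎
    where
    open ≡-Reasoning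
    s : ℕ
    s = A + B + inflowC qs ps (toℕ i ∸ B)

  ind-level : ∀ {A B qs ps a b g} → Fired c (below a) (below b) g → CalibratedI A B qs ps → b ≤ n →
              ∀ j → A ≤ toℕ j → ¬ toℕ j < a →
              ci g j + (B + inflowI qs ps (toℕ j ∸ A)) ≡ (n + 1) + b
  ind-level {A} {B} {qs} {ps} {a} {b} {g} f cal b≤n j A≤j j≮a = begin
    ci g j + s                             ≡⟨ cong (_+ s) (at-ind-unfired f j (below-false a j j≮a)) ⟩
    suc (ci c j + countTrue (below {n} b)) + s ≡⟨ cong (λ k → suc (ci c j + k) + s) (countTrue-below b b≤n) ⟩
    suc (ci c j) + b + s                   ≡⟨ xy∙z≈xz∙y (suc (ci c j)) b s ⟩
    suc (ci c j) + s + b                   ≡⟨ cong (λ k → suc k + b) (cal j A≤j) ⟩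
    suc n + b                              ≡⟨ cong (_+ b) (+-comm 1 n) ⟩
    (n + 1) + b                            ∎
    where
    open ≡-Reasoning
    s : ℕ
    s = B + inflowI qs ps (toℕ j ∸ A)

  Q-round : ∀ {A B q p qs ps g} → WellShaped (q ∷ qs) (p ∷ ps) → A + (q + sum qs) ≡ d → B ≤ n →
            CalibratedI A B (q ∷ qs) (p ∷ ps) → Fired c (below A) (below B) g →
            ∀ j → (below A j ∨ QSet g j) ≡ below (A + q) j
  Q-round {A} {B} {q} {p} {qs} {ps} {g} shape ΣA B≤n cal f j with toℕ j <? A
  ... | yes j<A = trans (∨-trueˡ _ (below-true A j j<A)) (sym (below-true (A + q) j (≤-trans j<A (m≤m+n A q))))
  ... | no  j≮A = trans (cong (_∨ QSet g j) (below-false A j j≮A))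
                        (decide (ind-level {A} {B} {q ∷ qs} {p ∷ ps} f cal B≤n j (≮⇒≥ j≮A) j≮A))
    where
    decide : ci g j + (B + inflowI (q ∷ qs) (p ∷ ps) (toℕ j ∸ A)) ≡ (n + 1) + B → QSet g j ≡ below (A + q) j
    decide level with toℕ j ∸ A <? q
    ... | yes in-block =
      trans (dec-true (n + 1 ≤? ci g j)
                      (level⇒≥ level (≤-reflexive (trans (cong (B +_) (inflowI-here q p qs ps _ in-block)) (+-identityʳ B)))))
            (sym (below-true (A + q) j (∸-<⇒< A (≮⇒≥ j≮A) in-block)))
    ... | no  beyond =
      trans (dec-false (n + 1 ≤? ci g j)
                       (<⇒≱ (level⇒< level (m<m+n B (inflowI-after-block shape _ j∸A<Σ beyond)))))
            (sym (below-false (A + q) j λ j<A+q → beyond (∸-<-split A j≮A j<A+q)))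
      where
      j∸A<Σ : toℕ j ∸ A < q + sum qs
      j∸A<Σ = ∸-<-split A j≮A (subst (toℕ j <_) (sym ΣA) (Fin.toℕ<n j))

  P-round : ∀ {A B q p qs ps g} → WellShaped (q ∷ qs) (p ∷ ps) → A + q ≤ d → B + (p + sum ps) ≡ n →
            CalibratedC A B (q ∷ qs) (p ∷ ps) → Fired c (below (A + q)) (below B) g →
            ∀ i → (below B i ∨ PSet g i) ≡ below (B + p) i
  P-round {A} {B} {q} {p} {qs} {ps} {g} shape A+q≤d ΣB cal f i with toℕ i <? B
  ... | yes i<B = trans (∨-trueˡ _ (below-true B i i<B)) (sym (below-true (B + p) i (≤-trans i<B (m≤m+n B p))))
  ... | no  i≮B = trans (cong (_∨ PSet g i) (below-false B i i≮B))
                        (decide (clq-level {A} {B} {q ∷ qs} {p ∷ ps} f cal A+q≤d (m+n≤o⇒m≤o B (≤-reflexive ΣB))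
                                           i (≮⇒≥ i≮B) i≮B))
    where
    decide : cc g i + (A + B + inflowC (q ∷ qs) (p ∷ ps) (toℕ i ∸ B)) ≡ (n + d) + ((A + q) + B) →
             PSet g i ≡ below (B + p) i
    decide level with toℕ i ∸ B <? p
    ... | yes in-block =
      trans (dec-true (n + d ≤? cc g i)
                      (level⇒≥ level (≤-reflexive (trans (cong (A + B +_) (inflowC-here q p qs ps _ in-block))
                                                         (xy∙z≈xz∙y A B q)))))
            (sym (below-true (B + p) i (∸-<⇒< B (≮⇒≥ i≮B) in-block)))
    ... | no  beyond =
      trans (dec-false (n + d ≤? cc g i)
                       (<⇒≱ (level⇒< level (subst (_< A + B + inflowC (q ∷ qs) (p ∷ ps) (toℕ i ∸ B)) (xy∙z≈xz∙y A B q)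
                                              (+-monoʳ-< (A + B) (inflowC-after-block shape _ i∸B<Σ beyond))))))
            (sym (below-false (B + p) i λ i<B+p → beyond (∸-<-split B i≮B i<B+p)))
      where
      i∸B<Σ : toℕ i ∸ B < p + sum ps
      i∸B<Σ = ∸-<-split B i≮B (subst (toℕ i <_) (sym ΣB) (Fin.toℕ<n i))

  calibrated-unstable : ∀ {qs ps A B g} → WellShaped qs ps → A + sum qs ≡ d → B + sum ps ≡ n →
                        CalibratedC A B qs ps → CalibratedI A B qs ps → Fired c (below A) (below B) g → ¬ Stable g
  calibrated-unstable {suc q ∷ qs} {p ∷ ps} {A} {B} {g} _ ΣA ΣB _ calI f (_ , stable-ind) =
    <⇒≱ (stable-ind j) (level⇒≥ level (≤-reflexive (trans (cong (B +_) inflow≡0) (+-identityʳ B))))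
    where
    A<d : A < d
    A<d = subst (A <_) ΣA (m<m+n A (s≤s z≤n))
    j : Fin d
    j = fromℕ< A<d
    j≡A : toℕ j ≡ A
    j≡A = Fin.toℕ-fromℕ< A<d
    level : ci g j + (B + inflowI (suc q ∷ qs) (p ∷ ps) (toℕ j ∸ A)) ≡ (n + 1) + B
    level = ind-level {A} {B} {suc q ∷ qs} {p ∷ ps} f calI (m+n≤o⇒m≤o B (≤-reflexive ΣB)) j
              (≤-reflexive (sym j≡A)) (λ j<A → <-irrefl j≡A j<A)
    inflow≡0 : inflowI (suc q ∷ qs) (p ∷ ps) (toℕ j ∸ A) ≡ 0
    inflow≡0 rewrite j≡A | n∸n≡0 A = inflowI-here (suc q) p qs ps 0 (s≤s z≤n)
  calibrated-unstable {zero ∷ qs} {p ∷ ps} {A} {B} {g} shape ΣA ΣB calC _ f (stable-clq , _) =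
    <⇒≱ (stable-clq i) (level⇒≥ level (≤-reflexive (trans (cong (A + B +_) inflow≡0) (+-identityʳ (A + B)))))
    where
    head-clq : WellShaped (0 ∷ qs) (p ∷ ps) → 1 ≤ p
    head-clq (last (inj₁ 1≤p)) = 1≤p
    head-clq (cons 1≤p _)      = 1≤p
    1≤p : 1 ≤ p
    1≤p = head-clq shape
    B<n : B < n
    B<n = subst (B <_) ΣB (m<m+n B (≤-trans 1≤p (m≤m+n p (sum ps))))
    i : Fin n
    i = fromℕ< B<n
    i≡B : toℕ i ≡ B
    i≡B = Fin.toℕ-fromℕ< B<n
    level : cc g i + (A + B + inflowC (0 ∷ qs) (p ∷ ps) (toℕ i ∸ B)) ≡ (n + d) + (A + B)
    level = clq-level {A} {B} {0 ∷ qs} {p ∷ ps} f calC (m+n≤o⇒m≤o A (≤-reflexive ΣA)) (<⇒≤ B<n) i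
              (≤-reflexive (sym i≡B)) (λ i<B → <-irrefl i≡B i<B)
    inflow≡0 : inflowC (0 ∷ qs) (p ∷ ps) (toℕ i ∸ B) ≡ 0
    inflow≡0 rewrite i≡B | n∸n≡0 B = inflowC-here 0 p qs ps 0 1≤p
  calibrated-unstable {[]}    ()
  calibrated-unstable {_ ∷ _} {[]} ()

  realise-run : ∀ {qs ps} → WellShaped qs ps → ∀ {A B g} → A + sum qs ≡ d → B + sum ps ≡ n →
                CalibratedC A B qs ps → CalibratedI A B qs ps → Fired c (below A) (below B) g → ITCRun g qs ps
  realise-run {q ∷ qs} {p ∷ ps} shape {A} {B} {g} ΣA ΣB calC calI f = round shape
    where
    ΣA′ : A + q + sum qs ≡ d
    ΣA′ = trans (+-assoc A q (sum qs)) ΣA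
    ΣB′ : B + p + sum ps ≡ n
    ΣB′ = trans (+-assoc B p (sum ps)) ΣB
    A+q≤d : A + q ≤ d
    A+q≤d = m+n≤o⇒m≤o (A + q) (≤-reflexive ΣA′)
    B+p≤n : B + p ≤ n
    B+p≤n = m+n≤o⇒m≤o (B + p) (≤-reflexive ΣB′)
    Q-ext : ∀ j → (below A j ∨ QSet g j) ≡ below (A + q) j
    Q-ext = Q-round shape ΣA (m+n≤o⇒m≤o B (≤-reflexive ΣB)) calI f
    fQ : Fired c (below (A + q)) (below B) (afterQ g)
    fQ = Fired-cong Q-ext (λ _ → refl) (proj₁ (Fired-afterQ stable f))
    |Q| : countTrue (QSet g) ≡ q
    |Q| = countTrue-block A q (QSet g) A+q≤d (proj₂ (Fired-afterQ stable f)) Q-ext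
    P-ext : ∀ i → (below B i ∨ PSet (afterQ g) i) ≡ below (B + p) i
    P-ext = P-round shape A+q≤d ΣB calC fQ
    fP : Fired c (below (A + q)) (below (B + p)) (afterQP g)
    fP = Fired-cong (λ _ → refl) P-ext (proj₁ (Fired-toppleC-PSet stable fQ))
    |P| : countTrue (PSet (afterQ g)) ≡ p
    |P| = countTrue-block B p (PSet (afterQ g)) B+p≤n (proj₂ (Fired-toppleC-PSet stable fQ)) P-ext
    round : WellShaped (q ∷ qs) (p ∷ ps) → ITCRun g (q ∷ qs) (p ∷ ps)
    round (last _) = subst₂ (ITCRun g) (cong (_∷ []) |Q|) (cong (_∷ []) |P|) (stop (Fired-all⇒stable stable fP all-Q all-P))
      where
      all-Q : ∀ j → below (A + q) j ≡ true
      all-Q j = below-true (A + q) j (subst (toℕ j <_) (sym (trans (sym (+-identityʳ _)) ΣA′)) (Fin.toℕ<n j))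
      all-P : ∀ i → below (B + p) i ≡ true
      all-P i = below-true (B + p) i (subst (toℕ i <_) (sym (trans (sym (+-identityʳ _)) ΣB′)) (Fin.toℕ<n i))
    round (cons _ shape′) = subst₂ (ITCRun g) (cong (_∷ qs) |Q|) (cong (_∷ ps) |P|)
      (next (calibrated-unstable shape′ ΣA′ ΣB′ calC′ calI′ fP) (realise-run shape′ ΣA′ ΣB′ calC′ calI′ fP))
      where
      calC′ : CalibratedC (A + q) (B + p) qs ps
      calC′ = CalibratedC-next {A} {B} {q} {p} {qs} {ps} calC
      calI′ : CalibratedI (A + q) (B + p) qs ps
      calI′ = CalibratedI-next {A} {B} {q} {p} {qs} {ps} calI

  indRange-legal : ∀ {A B q p qs ps} m a g (rest : List (Vertex n d)) → CalibratedI A B (q ∷ qs) (p ∷ ps) →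
                   A ≤ a → a + m ≡ A + q → A + q ≤ d → B ≤ n → Fired c (below a) (below B) g →
                   (∀ g′ → Fired c (below (A + q)) (below B) g′ → LegalFrom g′ rest) → LegalFrom g (indRange a m ++ rest)
  indRange-legal {A} {B} zero a g rest _ _ a+0≡A+q _ _ f continue =
    continue g (subst (λ k → Fired c (below k) (below B) g) (trans (sym (+-identityʳ a)) a+0≡A+q) f)
  indRange-legal {A} {B} {q} {p} {qs} {ps} (suc m) a g rest cal A≤a a+m≡A+q A+q≤d B≤n f continue
    with indAt-ind a (≤-trans (+suc≡⇒< a+m≡A+q) A+q≤d)
  ... | j , e , j≡a = subst (λ v → LegalFrom g (v ∷ (indRange (suc a) m ++ rest))) (sym e) (unstable ,
      indRange-legal {A} {B} {q} {p} {qs} {ps} m (suc a) (topple g (ind j)) rest cal (m≤n⇒m≤1+n A≤a)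
                     (trans (sym (+-suc a m)) a+m≡A+q) A+q≤d B≤n f′ continue)
    where
    j≮a : ¬ toℕ j < a
    j≮a = λ j<a → <-irrefl j≡a j<a
    in-block : toℕ j ∸ A < q
    in-block = subst (λ k → k ∸ A < q) (sym j≡a) (subst (a ∸ A <_) (m+n∸m≡n A q) (∸-monoˡ-< (+suc≡⇒< a+m≡A+q) A≤a))
    unstable : n + 1 ≤ ci g j
    unstable = level⇒≥ (ind-level {A} {B} {q ∷ qs} {p ∷ ps} f cal B≤n j (subst (A ≤_) (sym j≡a) A≤a) j≮a)
                       (≤-reflexive (trans (cong (B +_) (inflowI-here q p qs ps _ in-block)) (+-identityʳ B)))
    f′ : Fired c (below (suc a)) (below B) (topple g (ind j))
    f′ = Fired-cong (below-suc a j j≡a) (λ _ → refl) (Fired-topple-ind j (below-false a j j≮a) unstable f)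

  clqRange-legal : ∀ {A B q p qs ps} m b g (rest : List (Vertex n d)) → CalibratedC A B (q ∷ qs) (p ∷ ps) →
                   B ≤ b → b + m ≡ B + p → A + q ≤ d → B + p ≤ n → Fired c (below (A + q)) (below b) g →
                   (∀ g′ → Fired c (below (A + q)) (below (B + p)) g′ → LegalFrom g′ rest) → LegalFrom g (clqRange b m ++ rest)
  clqRange-legal {A} {B} {q} zero b g rest _ _ b+0≡B+p _ _ f continue =
    continue g (subst (λ k → Fired c (below (A + q)) (below k) g) (trans (sym (+-identityʳ b)) b+0≡B+p) f)
  clqRange-legal {A} {B} {q} {p} {qs} {ps} (suc m) b g rest cal B≤b b+m≡B+p A+q≤d B+p≤n f continue
    with clqAt-clq b (≤-trans (+suc≡⇒< b+m≡B+p) B+p≤n)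
  ... | i , e , i≡b = subst (λ v → LegalFrom g (v ∷ (clqRange (suc b) m ++ rest))) (sym e) (unstable ,
      clqRange-legal {A} {B} {q} {p} {qs} {ps} m (suc b) (topple g (clq i)) rest cal (m≤n⇒m≤1+n B≤b)
                     (trans (sym (+-suc b m)) b+m≡B+p) A+q≤d B+p≤n f′ continue)
    where
    i≮b : ¬ toℕ i < b
    i≮b = λ i<b → <-irrefl i≡b i<b
    in-block : toℕ i ∸ B < p
    in-block = subst (λ k → k ∸ B < p) (sym i≡b) (subst (b ∸ B <_) (m+n∸m≡n B p) (∸-monoˡ-< (+suc≡⇒< b+m≡B+p) B≤b))
    unstable : n + d ≤ cc g i
    unstable = level⇒≥ (clq-level {A} {B} {q ∷ qs} {p ∷ ps} f cal A+q≤d (≤-trans (<⇒≤ (+suc≡⇒< b+m≡B+p)) B+p≤n) i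
                                  (subst (B ≤_) (sym i≡b) B≤b) i≮b)
                       (begin
                         A + B + inflowC (q ∷ qs) (p ∷ ps) (toℕ i ∸ B) ≡⟨ cong (A + B +_) (inflowC-here q p qs ps _ in-block) ⟩
                         A + B + q                                     ≡⟨ xy∙z≈xz∙y A B q ⟩
                         A + q + B                                     ≤⟨ +-monoʳ-≤ (A + q) B≤b ⟩
                         A + q + b                                     ∎)
      where open ≤-Reasoning
    f′ : Fired c (below (A + q)) (below (suc b)) (topple g (clq i))
    f′ = Fired-cong (λ _ → refl) (below-suc b i i≡b) (Fired-topple-clq i (below-false b i i≮b) unstable f)

  itcOrder-legal : ∀ {qs ps} → WellShaped qs ps → ∀ {A B g} → A + sum qs ≡ d → B + sum ps ≡ n →
                   CalibratedC A B qs ps → CalibratedI A B qs ps → Fired c (below A) (below B) g →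
                   LegalFrom g (itcOrder A B qs ps)
  itcOrder-legal {q ∷ qs} {p ∷ ps} shape {A} {B} {g} ΣA ΣB calC calI f =
    indRange-legal {A} {B} {q} {p} {qs} {ps} q A g _ calI ≤-refl refl A+q≤d (m+n≤o⇒m≤o B (≤-reflexive ΣB)) f λ g′ f′ →
      clqRange-legal {A} {B} {q} {p} {qs} {ps} p B g′ _ calC ≤-refl refl A+q≤d B+p≤n f′ λ _ f″ →
        later shape f″
    where
    ΣA′ : A + q + sum qs ≡ d
    ΣA′ = trans (+-assoc A q (sum qs)) ΣA
    ΣB′ : B + p + sum ps ≡ n
    ΣB′ = trans (+-assoc B p (sum ps)) ΣB
    A+q≤d : A + q ≤ d
    A+q≤d = m+n≤o⇒m≤o (A + q) (≤-reflexive ΣA′)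
    B+p≤n : B + p ≤ n
    B+p≤n = m+n≤o⇒m≤o (B + p) (≤-reflexive ΣB′)
    later : WellShaped (q ∷ qs) (p ∷ ps) → ∀ {g″} → Fired c (below (A + q)) (below (B + p)) g″ →
            LegalFrom g″ (itcOrder (A + q) (B + p) qs ps)
    later (last _)        _ = tt
    later (cons _ shape′) f″ = itcOrder-legal shape′ ΣA′ ΣB′
      (CalibratedC-next {A} {B} {q} {p} {qs} {ps} calC) (CalibratedI-next {A} {B} {q} {p} {qs} {ps} calI) f″

-- Every vertex is one grain short of tipping over once it has received the sink's
-- grain and its inflow.
configOf : ∀ n d → List ℕ → List ℕ → Config n d
configOf n d qs ps = cfg (λ i → (n + d ∸ 1) ∸ inflowC qs ps (toℕ i)) (λ j → n ∸ inflowI qs ps (toℕ j))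

realise : ∀ {n d qs ps} → 1 ≤ n → WellShaped qs ps → sum qs ≡ d → sum ps ≡ n →
          Σ (Config n d) λ c → SortedRec c × ITCRun (topple c sink) qs ps
realise {suc n′} {d} {qs} {ps} _ shape Σqs Σps =
  c , ((stable , itcOrder 0 0 qs ps , unique , covers , legal) , decreasingC , decreasingI) , run
  where
  n : ℕ
  n = suc n′
  c : Config n d
  c = configOf n d qs ps
  stable : Stable c
  stable = (λ i → s≤s (m∸n≤m (n′ + d) (inflowC qs ps (toℕ i))))
         , (λ j → ≤-<-trans (m∸n≤m n (inflowI qs ps (toℕ j))) (subst (n <_) (+-comm 1 n) (n<1+n n)))
  open Realisation c stable
  calC : CalibratedC 0 0 qs ps
  calC i _ = cong suc (m∸n+n≡m (≤-pred (subst (inflowC qs ps (toℕ i) <_) sum≡ bound)))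
    where
    bound : inflowC qs ps (toℕ i) < sum qs + sum ps
    bound = inflowC-bound qs ps (toℕ i) (subst (toℕ i <_) (sym Σps) (Fin.toℕ<n i))
    sum≡ : sum qs + sum ps ≡ suc (n′ + d)
    sum≡ = trans (cong₂ _+_ Σqs Σps) (trans (+-suc d n′) (cong suc (+-comm d n′)))
  calI : CalibratedI 0 0 qs ps
  calI j _ = m∸n+n≡m (subst (inflowI qs ps (toℕ j) ≤_) Σps
                        (inflowI-bound qs ps (toℕ j) (subst (toℕ j <_) (sym Σqs) (Fin.toℕ<n j))))
  f₀ : Fired c (below 0) (below 0) (topple c sink)
  f₀ = Fired-cong below-0 below-0 Fired-sink
  order : Unique (itcOrder 0 0 qs ps) × All (Beyond 0 0) (itcOrder 0 0 qs ps)
  order = itcOrder-unique qs ps 0 0 (≤-reflexive Σqs) (≤-reflexive Σps)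
  sink∉ : ∀ {v} → Beyond 0 0 v → sink ≢ v
  sink∉ {ind _} _ ()
  sink∉ {clq _} _ ()
  unique : Unique (sink ∷ itcOrder 0 0 qs ps)
  unique = All.map sink∉ (proj₂ order) ∷ proj₁ order
  covers : ∀ v → v ∈ sink ∷ itcOrder 0 0 qs ps
  covers sink    = here refl
  covers (ind j) = there (ind∈itcOrder shape 0 0 Σqs j z≤n)
  covers (clq i) = there (clq∈itcOrder shape 0 0 Σps i z≤n)
  legal : LegalFrom (topple c sink) (itcOrder 0 0 qs ps)
  legal = itcOrder-legal shape Σqs Σps calC calI f₀
  decreasingC : WeaklyDecreasing (cc c)
  decreasingC i j i≤j = ∸-monoʳ-≤ (n′ + d) (inflowC-mono qs ps i≤j)
  decreasingI : WeaklyDecreasing (ci c)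
  decreasingI i j i≤j = ∸-monoʳ-≤ n (inflowI-mono qs ps i≤j)
  run : ITCRun (topple c sink) qs ps
  run = realise-run shape Σqs Σps calC calI f₀

Admissible : ℕ → ℕ → ℕ → List ℕ × List ℕ → Set
Admissible n d k (qs , ps) = WellShaped qs ps × sum qs ≡ d × sum ps ≡ n × length qs ≡ k

ITCk⇔Admissible : ∀ {n d} → 1 ≤ n → ∀ k x → ITCk n d k x ⇔ Admissible n d k x
ITCk⇔Admissible 1≤n k (qs , ps) = mk⇔
  (λ (_ , sorted , run , len) → let shape , Σqs , Σps = ITCRun-sound 1≤n sorted run in shape , Σqs , Σps , len)
  (λ (shape , Σqs , Σps , len) → let c , sorted , run = realise 1≤n shape Σqs Σps in c , sorted , run , len)

-- Compositions

nC0≡1 : ∀ n → n C 0 ≡ 1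
nC0≡1 n = trans (nCk≡nC[n∸k] {0} {n} z≤n) (nCn≡1 n)

incHead : List ℕ → List ℕ
incHead []       = []
incHead (x ∷ xs) = suc x ∷ xs

incHead-injective : ∀ {xs ys} → incHead xs ≡ incHead ys → xs ≡ ys
incHead-injective {[]}    {[]}    _    = refl
incHead-injective {_ ∷ _} {_ ∷ _} refl = refl

weakCompositions : ℕ → ℕ → List (List ℕ)
weakCompositions zero    zero    = [] ∷ []
weakCompositions (suc d) zero    = []
weakCompositions zero    (suc k) = replicate (suc k) 0 ∷ []
weakCompositions (suc d) (suc k) =
  map (0 ∷_) (weakCompositions (suc d) k) ++ map incHead (weakCompositions d (suc k))

sum-replicate-0 : ∀ k → sum (replicate k 0) ≡ 0
sum-replicate-0 zero    = refl
sum-replicate-0 (suc k) = sum-replicate-0 k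

sum≡0⇒replicate : ∀ xs → sum xs ≡ 0 → xs ≡ replicate (length xs) 0
sum≡0⇒replicate []         _ = refl
sum≡0⇒replicate (zero ∷ xs) e = cong (0 ∷_) (sum≡0⇒replicate xs e)

∈-weakCompositions⁻ : ∀ d k {xs} → xs ∈ weakCompositions d k → length xs ≡ k × sum xs ≡ d
∈-weakCompositions⁻ zero    zero    (here refl) = refl , refl
∈-weakCompositions⁻ zero    (suc k) (here refl) = length-replicate (suc k) , sum-replicate-0 (suc k)
∈-weakCompositions⁻ (suc d) (suc k) xs∈ with ∈-++⁻ (map (0 ∷_) (weakCompositions (suc d) k)) xs∈
... | inj₁ ∈zeros with ys , ys∈ , refl ← ∈-map⁻ (0 ∷_) ∈zeros =
  let len , Σ = ∈-weakCompositions⁻ (suc d) k ys∈ in cong suc len , Σ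
∈-weakCompositions⁻ (suc d) (suc k) xs∈ | inj₂ ∈incs with ∈-map⁻ incHead ∈incs
... | y ∷ ys , ys∈ , refl = let len , Σ = ∈-weakCompositions⁻ d (suc k) ys∈ in len , cong suc Σ
... | []     , ys∈ , refl with () ← proj₁ (∈-weakCompositions⁻ d (suc k) ys∈)

∈-weakCompositions⁺ : ∀ d k {xs} → length xs ≡ k → sum xs ≡ d → xs ∈ weakCompositions d k
∈-weakCompositions⁺ zero    zero    {[]}        _   _ = here refl
∈-weakCompositions⁺ (suc d) zero    {[]}        _   ()
∈-weakCompositions⁺ zero    (suc k) {xs}        len Σ = here (trans (sum≡0⇒replicate xs Σ) (cong (λ m → replicate m 0) len))
∈-weakCompositions⁺ (suc d) (suc k) {zero ∷ xs} len Σ =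
  ∈-++⁺ˡ (∈-map⁺ (0 ∷_) (∈-weakCompositions⁺ (suc d) k (suc-injective len) Σ))
∈-weakCompositions⁺ (suc d) (suc k) {suc x ∷ xs} len Σ =
  ∈-++⁺ʳ (map (0 ∷_) (weakCompositions (suc d) k)) (∈-map⁺ incHead (∈-weakCompositions⁺ d (suc k) len (suc-injective Σ)))

weakCompositions-unique : ∀ d k → Unique (weakCompositions d k)
weakCompositions-unique zero    zero    = [] ∷ []
weakCompositions-unique (suc d) zero    = []
weakCompositions-unique zero    (suc k) = [] ∷ []
weakCompositions-unique (suc d) (suc k) =
  Unique.++⁺ (Unique.map⁺ (λ { refl → refl }) (weakCompositions-unique (suc d) k))
             (Unique.map⁺ incHead-injective (weakCompositions-unique d (suc k))) disjoint
  where
  disjoint : ∀ {v} → v ∈ map (0 ∷_) (weakCompositions (suc d) k) × v ∈ map incHead (weakCompositions d (suc k)) → ⊥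
  disjoint (∈zeros , ∈incs) with ∈-map⁻ (0 ∷_) ∈zeros | ∈-map⁻ incHead ∈incs
  ... | _ , _ , refl | _ ∷ _ , _ , ()

length-weakCompositions : ∀ d k → length (weakCompositions d (suc k)) ≡ (d + k) C d
length-weakCompositions zero    k       = sym (nC0≡1 k)
length-weakCompositions (suc d) zero    = begin
  length (map incHead (weakCompositions d 1)) ≡⟨ length-map incHead (weakCompositions d 1) ⟩
  length (weakCompositions d 1)               ≡⟨ length-weakCompositions d 0 ⟩
  (d + 0) C d                   ≡⟨ cong (_C d) (+-identityʳ d) ⟩
  d C d                         ≡⟨ nCn≡1 d ⟩
  1                             ≡⟨ sym (nCn≡1 (suc d)) ⟩
  suc d C suc d                 ≡⟨ cong (_C suc d) (sym (+-identityʳ (suc d))) ⟩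
  (suc d + 0) C suc d           ∎
  where open ≡-Reasoning
length-weakCompositions (suc d) (suc k) = begin
  length (map (0 ∷_) (weakCompositions (suc d) (suc k)) ++ map incHead (weakCompositions d (suc (suc k))))
    ≡⟨ length-++ (map (0 ∷_) (weakCompositions (suc d) (suc k))) ⟩
  length (map (0 ∷_) (weakCompositions (suc d) (suc k))) + length (map incHead (weakCompositions d (suc (suc k))))
    ≡⟨ cong₂ _+_ (length-map _ (weakCompositions (suc d) (suc k))) (length-map _ (weakCompositions d (suc (suc k)))) ⟩
  length (weakCompositions (suc d) (suc k)) + length (weakCompositions d (suc (suc k)))
    ≡⟨ cong₂ _+_ (length-weakCompositions (suc d) k) (length-weakCompositions d (suc k)) ⟩
  (suc d + k) C suc d + (d + suc k) C d
    ≡⟨ cong (λ m → m C suc d + (d + suc k) C d) (sym (+-suc d k)) ⟩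
  (d + suc k) C suc d + (d + suc k) C d
    ≡⟨ +-comm ((d + suc k) C suc d) _ ⟩
  (d + suc k) C d + (d + suc k) C suc d
    ≡⟨ nCk+nC[k+1]≡[n+1]C[k+1] (d + suc k) d ⟩
  (suc d + suc k) C suc d ∎
  where open ≡-Reasoning

Positive : List ℕ → Set
Positive = All (1 ≤_)

sum-map-suc : ∀ xs → sum (map suc xs) ≡ length xs + sum xs
sum-map-suc []       = refl
sum-map-suc (x ∷ xs) = cong suc (trans (cong (x +_) (sum-map-suc xs)) (x∙yz≈y∙xz x (length xs) (sum xs)))

map-suc-pred : ∀ {ps} → Positive ps → map suc (map pred ps) ≡ ps
map-suc-pred []                      = refl
map-suc-pred {suc p ∷ _} (_ ∷ pos) = cong (suc p ∷_) (map-suc-pred pos)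

sum-map-pred : ∀ {ps} → Positive ps → sum (map pred ps) + length ps ≡ sum ps
sum-map-pred {ps} pos = begin
  sum (map pred ps) + length ps             ≡⟨ +-comm _ (length ps) ⟩
  length ps + sum (map pred ps)             ≡⟨ cong (_+ sum (map pred ps)) (sym (length-map pred ps)) ⟩
  length (map pred ps) + sum (map pred ps)  ≡⟨ sym (sum-map-suc (map pred ps)) ⟩
  sum (map suc (map pred ps))               ≡⟨ cong sum (map-suc-pred pos) ⟩
  sum ps                                    ∎
  where open ≡-Reasoning

length≤sum : ∀ {ps} → Positive ps → length ps ≤ sum ps
length≤sum {ps} pos = subst (length ps ≤_) (sum-map-pred pos) (m≤n+m (length ps) _)

Positive-map-suc : ∀ xs → Positive (map suc xs)
Positive-map-suc []       = []
Positive-map-suc (_ ∷ xs) = s≤s z≤n ∷ Positive-map-suc xs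

compositions : ℕ → ℕ → List (List ℕ)
compositions n k with k ≤? n
... | yes _ = map (map suc) (weakCompositions (n ∸ k) k)
... | no  _ = []

∈-compositions⁻ : ∀ n k {ps} → ps ∈ compositions n k → length ps ≡ k × Positive ps × sum ps ≡ n
∈-compositions⁻ n k ps∈ with k ≤? n
... | yes k≤n with xs , xs∈ , refl ← ∈-map⁻ (map suc) ps∈ =
  let len , Σ = ∈-weakCompositions⁻ (n ∸ k) k xs∈
  in trans (length-map suc xs) len , Positive-map-suc xs , trans (sum-map-suc xs) (trans (cong₂ _+_ len Σ) (m+[n∸m]≡n k≤n))

∈-compositions⁺ : ∀ n k {ps} → length ps ≡ k → Positive ps → sum ps ≡ n → ps ∈ compositions n k
∈-compositions⁺ n k {ps} len pos Σ with k ≤? n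
... | yes k≤n = subst (_∈ map (map suc) (weakCompositions (n ∸ k) k)) (map-suc-pred pos)
                  (∈-map⁺ (map suc) (∈-weakCompositions⁺ (n ∸ k) k (trans (length-map pred ps) len) Σ′))
  where
  Σ′ : sum (map pred ps) ≡ n ∸ k
  Σ′ = trans (sym (m+n∸n≡m _ (length ps))) (trans (cong (_∸ length ps) (sum-map-pred pos)) (cong₂ _∸_ Σ len))
... | no  k≰n = contradiction (subst₂ _≤_ len Σ (length≤sum pos)) k≰n

compositions-length≤ : ∀ {n k ps} → ps ∈ compositions n k → k ≤ n
compositions-length≤ {n} {k} ps∈ = let len , pos , Σ = ∈-compositions⁻ n k ps∈ in subst₂ _≤_ len Σ (length≤sum pos)

compositions-unique : ∀ n k → Unique (compositions n k)
compositions-unique n k with k ≤? n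
... | yes _ = Unique.map⁺ (map-injective suc-injective) (weakCompositions-unique (n ∸ k) k)
... | no  _ = []

length-compositions : ∀ n k → length (compositions (suc n) (suc k)) ≡ n C k
length-compositions n k with suc k ≤? suc n
... | yes (s≤s k≤n) = begin
  length (map (map suc) (weakCompositions (n ∸ k) (suc k))) ≡⟨ length-map (map suc) (weakCompositions (n ∸ k) (suc k)) ⟩
  length (weakCompositions (n ∸ k) (suc k))                 ≡⟨ length-weakCompositions (n ∸ k) k ⟩
  (n ∸ k + k) C (n ∸ k)                                      ≡⟨ cong (_C (n ∸ k)) (m∸n+n≡m k≤n) ⟩
  n C (n ∸ k)                                                ≡⟨ sym (nCk≡nC[n∸k] k≤n) ⟩
  n C k                                                      ∎
  where open ≡-Reasoning
... | no  k≰n = sym (k>n⇒nCk≡0 (≤-pred (≰⇒> k≰n)))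

compositions-0 : ∀ n → compositions (suc n) 0 ≡ []
compositions-0 n with 0 ≤? suc n
... | yes _ = refl
... | no  _ = refl

-- Admissible sequences

incLast : List ℕ → List ℕ
incLast []           = []
incLast (x ∷ [])     = suc x ∷ []
incLast (x ∷ y ∷ ys) = x ∷ incLast (y ∷ ys)

length-incLast : ∀ xs → length (incLast xs) ≡ length xs
length-incLast []           = refl
length-incLast (x ∷ [])     = refl
length-incLast (x ∷ y ∷ ys) = cong suc (length-incLast (y ∷ ys))

sum-incLast : ∀ xs → 1 ≤ length xs → sum (incLast xs) ≡ suc (sum xs)
sum-incLast (x ∷ [])     _ = refl
sum-incLast (x ∷ y ∷ ys) _ = trans (cong (x +_) (sum-incLast (y ∷ ys) (s≤s z≤n))) (+-suc x _)

incLast-nonempty : ∀ y ys → incLast (y ∷ ys) ≢ []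
incLast-nonempty y []      ()
incLast-nonempty y (_ ∷ _) ()

incLast-injective : ∀ {xs ys} → incLast xs ≡ incLast ys → xs ≡ ys
incLast-injective {[]}         {[]}           _    = refl
incLast-injective {x ∷ []}     {y ∷ []}       refl = refl
incLast-injective {x ∷ y ∷ xs} {x′ ∷ y′ ∷ ys} e =
  cong₂ _∷_ (proj₁ (∷-injective e)) (incLast-injective {y ∷ xs} {y′ ∷ ys} (proj₂ (∷-injective e)))
incLast-injective {x ∷ []}     {_ ∷ y′ ∷ ys}  e = contradiction (sym (proj₂ (∷-injective e))) (incLast-nonempty y′ ys)
incLast-injective {_ ∷ y ∷ xs} {x′ ∷ []}      e = contradiction (proj₂ (∷-injective e)) (incLast-nonempty y xs)
incLast-injective {[]}         {_ ∷ []}       ()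
incLast-injective {[]}         {_ ∷ _ ∷ _}    ()
incLast-injective {_ ∷ []}     {[]}           ()
incLast-injective {_ ∷ _ ∷ _}  {[]}           ()

sum-∷ʳ0 : ∀ ps → sum (ps ∷ʳ 0) ≡ sum ps
sum-∷ʳ0 ps = foldr-∷ʳ _+_ 0 0 ps

WellShaped-positive : ∀ qs ps → Positive ps → length qs ≡ length ps → 1 ≤ length ps → WellShaped qs ps
WellShaped-positive (q ∷ [])      (p ∷ [])      (1≤p ∷ [])  _   _ = last (inj₁ 1≤p)
WellShaped-positive (q ∷ q′ ∷ qs) (p ∷ p′ ∷ ps) (1≤p ∷ pos) len _ =
  cons 1≤p (WellShaped-positive (q′ ∷ qs) (p′ ∷ ps) pos (suc-injective len) (s≤s z≤n))
WellShaped-positive []            (_ ∷ _)       _ () _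
WellShaped-positive (_ ∷ [])      (_ ∷ _ ∷ _)   _ () _
WellShaped-positive (_ ∷ _ ∷ _)   (_ ∷ [])      _ () _

WellShaped-zeroEnded : ∀ qs ps → Positive ps → length qs ≡ suc (length ps) → WellShaped (incLast qs) (ps ∷ʳ 0)
WellShaped-zeroEnded (q ∷ [])     []       []          _   = last (inj₂ (s≤s z≤n))
WellShaped-zeroEnded (q ∷ y ∷ ys) (p ∷ ps) (1≤p ∷ pos) len = cons 1≤p (WellShaped-zeroEnded (y ∷ ys) ps pos (suc-injective len))
WellShaped-zeroEnded []           _        _           ()
WellShaped-zeroEnded (_ ∷ _ ∷ _)  []       _           ()
WellShaped-zeroEnded (_ ∷ [])     (_ ∷ _)  _           ()

ZeroEnded : List ℕ → List ℕ → Set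
ZeroEnded qs ps = Σ (List ℕ) λ qs′ → Σ (List ℕ) λ ps′ →
  qs ≡ incLast qs′ × ps ≡ ps′ ∷ʳ 0 × Positive ps′ × length qs′ ≡ suc (length ps′)

WellShaped-split : ∀ {qs ps} → WellShaped qs ps → (Positive ps × length qs ≡ length ps) ⊎ ZeroEnded qs ps
WellShaped-split (last {_}     {suc p} _)        = inj₁ (s≤s z≤n ∷ [] , refl)
WellShaped-split (last {suc q} {zero}  _)        = inj₂ (q ∷ [] , [] , refl , refl , [] , refl)
WellShaped-split (last {zero}  {zero}  (inj₁ ()))
WellShaped-split (last {zero}  {zero}  (inj₂ ()))
WellShaped-split (cons {q} {p} 1≤p shape) with WellShaped-split shape
... | inj₁ (pos , len) = inj₁ (1≤p ∷ pos , cong suc len)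
... | inj₂ (y ∷ ys , ps′ , refl , refl , pos , len) = inj₂ (q ∷ y ∷ ys , p ∷ ps′ , refl , refl , 1≤p ∷ pos , cong suc len)
... | inj₂ ([] , _ , _ , _ , _ , ())

length-cartesianProductWith : ∀ {A B C : Set} (f : A → B → C) xs ys →
                              length (cartesianProductWith f xs ys) ≡ length xs * length ys
length-cartesianProductWith f []       ys = refl
length-cartesianProductWith f (x ∷ xs) ys =
  trans (length-++ (map (f x) ys)) (cong₂ _+_ (length-map (f x) ys) (length-cartesianProductWith f xs ys))

Sequence : Set
Sequence = List ℕ × List ℕ

positiveSequence : List ℕ → List ℕ → Sequence
positiveSequence ps qs = qs , ps

zeroEndedSequence : List ℕ → List ℕ → Sequence
zeroEndedSequence ps qs = incLast qs , ps ∷ʳ 0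

positiveSequences : ℕ → ℕ → ℕ → List Sequence
positiveSequences n d k = cartesianProductWith positiveSequence (compositions n k) (weakCompositions d k)

zeroEndedSequences : ℕ → ℕ → ℕ → List Sequence
zeroEndedSequences n zero    k = []
zeroEndedSequences n (suc d) k = cartesianProductWith zeroEndedSequence (compositions n (pred k)) (weakCompositions d k)

admissibleSequences : ℕ → ℕ → ℕ → List Sequence
admissibleSequences n d k = positiveSequences n d k ++ zeroEndedSequences n d k

sum≡suc⇒nonempty : ∀ {n} ps → sum ps ≡ suc n → 1 ≤ length ps
sum≡suc⇒nonempty (_ ∷ _) _ = s≤s z≤n

module _ (n : ℕ) where

  ∈-positiveSequences⁻ : ∀ d k {x} → x ∈ positiveSequences (suc n) d k → Admissible (suc n) d k x
  ∈-positiveSequences⁻ d k x∈ with ps , qs , ps∈ , qs∈ , refl ← ∈-cartesianProductWith⁻ positiveSequence _ _ x∈ =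
    let lenP , pos , Σps = ∈-compositions⁻ (suc n) k ps∈
        lenQ , Σqs = ∈-weakCompositions⁻ d k qs∈
    in WellShaped-positive qs ps pos (trans lenQ (sym lenP)) (sum≡suc⇒nonempty ps Σps) , Σqs , Σps , lenQ

  ∈-zeroEndedSequences⁻ : ∀ d k {x} → x ∈ zeroEndedSequences (suc n) d k → Admissible (suc n) d k x
  ∈-zeroEndedSequences⁻ (suc d′) k x∈ with ps , qs , ps∈ , qs∈ , refl ← ∈-cartesianProductWith⁻ zeroEndedSequence _ _ x∈ =
    admissible k (∈-compositions⁻ (suc n) (pred k) ps∈) (∈-weakCompositions⁻ d′ k qs∈)
    where
    admissible : ∀ k → length ps ≡ pred k × Positive ps × sum ps ≡ suc n → length qs ≡ k × sum qs ≡ d′ →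
                 Admissible (suc n) (suc d′) k (incLast qs , ps ∷ʳ 0)
    admissible zero    (lenP , _ , Σps) _ = contradiction (subst (1 ≤_) lenP (sum≡suc⇒nonempty ps Σps)) λ ()
    admissible (suc k) (lenP , pos , Σps) (lenQ , Σqs) =
      WellShaped-zeroEnded qs ps pos (trans lenQ (cong suc (sym lenP))) ,
      trans (sum-incLast qs (subst (1 ≤_) (sym lenQ) (s≤s z≤n))) (cong suc Σqs) ,
      trans (sum-∷ʳ0 ps) Σps ,
      trans (length-incLast qs) lenQ

  ∈-admissibleSequences⁻ : ∀ d k {x} → x ∈ admissibleSequences (suc n) d k → Admissible (suc n) d k x
  ∈-admissibleSequences⁻ d k x∈ with ∈-++⁻ (positiveSequences (suc n) d k) x∈
  ... | inj₁ x∈pos  = ∈-positiveSequences⁻ d k x∈pos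
  ... | inj₂ x∈zero = ∈-zeroEndedSequences⁻ d k x∈zero

  ∈-admissibleSequences⁺ : ∀ d k {qs ps} → Admissible (suc n) d k (qs , ps) → (qs , ps) ∈ admissibleSequences (suc n) d k
  ∈-admissibleSequences⁺ d k (shape , Σqs , Σps , lenQ) with WellShaped-split shape
  ... | inj₁ (pos , len) =
    ∈-++⁺ˡ (∈-cartesianProductWith⁺ positiveSequence
             (∈-compositions⁺ (suc n) k (trans (sym len) lenQ) pos Σps) (∈-weakCompositions⁺ d k lenQ Σqs))
  ... | inj₂ (qs′ , ps′ , refl , refl , pos , len) = ∈-++⁺ʳ (positiveSequences (suc n) d k) (zeroEnded d Σqs)
    where
    lenQ′ : length qs′ ≡ k
    lenQ′ = trans (sym (length-incLast qs′)) lenQ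
    Σqs′ : sum (incLast qs′) ≡ suc (sum qs′)
    Σqs′ = sum-incLast qs′ (subst (1 ≤_) (sym len) (s≤s z≤n))
    zeroEnded : ∀ d → sum (incLast qs′) ≡ d → (incLast qs′ , ps′ ∷ʳ 0) ∈ zeroEndedSequences (suc n) d k
    zeroEnded zero    Σ≡0 = contradiction (trans (sym Σqs′) Σ≡0) λ ()
    zeroEnded (suc d) Σ≡  = ∈-cartesianProductWith⁺ zeroEndedSequence
      (∈-compositions⁺ (suc n) (pred k) (cong pred (trans (sym len) lenQ′)) pos (trans (sym (sum-∷ʳ0 ps′)) Σps))
      (∈-weakCompositions⁺ d k lenQ′ (suc-injective (trans (sym Σqs′) Σ≡)))

positive#zeroEnded : ∀ n d k k′ {x} → x ∈ positiveSequences n d k → x ∈ zeroEndedSequences n d k′ → ⊥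
positive#zeroEnded n (suc d) k k′ x∈pos x∈zero
  with ps , _ , ps∈ , _ , refl ← ∈-cartesianProductWith⁻ positiveSequence (compositions n k) (weakCompositions (suc d) k) x∈pos
     | ps′ , _ , _ , _ , e ← ∈-cartesianProductWith⁻ zeroEndedSequence (compositions n (pred k′)) (weakCompositions d k′) x∈zero =
  contradiction (proj₂ (All.∷ʳ⁻ (subst Positive (cong proj₂ e) (proj₁ (proj₂ (∈-compositions⁻ n k ps∈)))))) λ ()

positiveSequences-unique : ∀ n d k → Unique (positiveSequences n d k)
positiveSequences-unique n d k = Unique.cartesianProductWith⁺ positiveSequence (λ e → cong proj₂ e , cong proj₁ e)
  (compositions-unique n k) (weakCompositions-unique d k)

zeroEndedSequences-unique : ∀ n d k → Unique (zeroEndedSequences n d k)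
zeroEndedSequences-unique n zero    k = []
zeroEndedSequences-unique n (suc d) k = Unique.cartesianProductWith⁺ zeroEndedSequence
  (λ {ps} {ps′} e → ∷ʳ-injectiveˡ ps ps′ (cong proj₂ e) , incLast-injective (cong proj₁ e))
  (compositions-unique n (pred k)) (weakCompositions-unique d k)

admissibleSequences-unique : ∀ n d k → Unique (admissibleSequences n d k)
admissibleSequences-unique n d k = Unique.++⁺ (positiveSequences-unique n d k) (zeroEndedSequences-unique n d k)
  λ (x∈pos , x∈zero) → positive#zeroEnded n d k k x∈pos x∈zero

length-positiveSequences : ∀ n d k → length (positiveSequences (suc n) d (suc k)) ≡ (n C k) * ((d + k) C d)
length-positiveSequences n d k =
  trans (length-cartesianProductWith positiveSequence (compositions (suc n) (suc k)) (weakCompositions d (suc k)))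
        (cong₂ _*_ (length-compositions n k) (length-weakCompositions d k))

length-zeroEndedSequences : ∀ n d k → length (zeroEndedSequences (suc n) (suc d) (suc (suc k))) ≡ (n C k) * ((d + suc k) C d)
length-zeroEndedSequences n d k =
  trans (length-cartesianProductWith zeroEndedSequence (compositions (suc n) (suc k)) (weakCompositions d (suc (suc k))))
        (cong₂ _*_ (length-compositions n k) (length-weakCompositions d (suc k)))

length-zeroEndedSequences-1 : ∀ n d → length (zeroEndedSequences (suc n) d 1) ≡ 0
length-zeroEndedSequences-1 n zero    = refl
length-zeroEndedSequences-1 n (suc d) rewrite compositions-0 n = refl

length-admissibleSequences-1 : ∀ n d → length (admissibleSequences (suc n) d 1) ≡ 1
length-admissibleSequences-1 n d = begin
  length (positiveSequences (suc n) d 1 ++ zeroEndedSequences (suc n) d 1)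
    ≡⟨ length-++ (positiveSequences (suc n) d 1) ⟩
  length (positiveSequences (suc n) d 1) + length (zeroEndedSequences (suc n) d 1)
    ≡⟨ cong₂ _+_ (length-positiveSequences n d 0) (length-zeroEndedSequences-1 n d) ⟩
  (n C 0) * ((d + 0) C d) + 0
    ≡⟨ cong₂ (λ a b → a * b + 0) (nC0≡1 n) (trans (cong (_C d) (+-identityʳ d)) (nCn≡1 d)) ⟩
  1 ∎
  where open ≡-Reasoning

-- With k = m + 2 this is the count of the theorem; binomℤ vanishes for d = 0, when
-- there are no zero-ended sequences.
length-admissibleSequences : ∀ n d m → length (admissibleSequences (suc n) d (suc (suc m))) ≡
  binomℤ (d + suc (suc m) ∸ 2) (ℤ.+ d ℤ.- ℤ.+ 1) * (n C m) + ((d + suc (suc m) ∸ 1) C d) * (n C suc m)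
length-admissibleSequences n zero m = begin
  length (positiveSequences (suc n) 0 (suc (suc m)) ++ []) ≡⟨ length-++ (positiveSequences (suc n) 0 (suc (suc m))) ⟩
  length (positiveSequences (suc n) 0 (suc (suc m))) + 0   ≡⟨ +-identityʳ _ ⟩
  length (positiveSequences (suc n) 0 (suc (suc m)))       ≡⟨ length-positiveSequences n 0 (suc m) ⟩
  (n C suc m) * (suc m C 0)                                ≡⟨ *-comm (n C suc m) _ ⟩
  (suc m C 0) * (n C suc m)                                ∎
  where open ≡-Reasoning
length-admissibleSequences n (suc d) m = begin
  length (positiveSequences (suc n) (suc d) (suc (suc m)) ++ zeroEndedSequences (suc n) (suc d) (suc (suc m)))
    ≡⟨ length-++ (positiveSequences (suc n) (suc d) (suc (suc m))) ⟩
  length (positiveSequences (suc n) (suc d) (suc (suc m))) + length (zeroEndedSequences (suc n) (suc d) (suc (suc m)))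
    ≡⟨ cong₂ _+_ (length-positiveSequences n (suc d) (suc m)) (length-zeroEndedSequences n d m) ⟩
  (n C suc m) * ((suc d + suc m) C suc d) + (n C m) * ((d + suc m) C d)
    ≡⟨ +-comm ((n C suc m) * ((suc d + suc m) C suc d)) _ ⟩
  (n C m) * ((d + suc m) C d) + (n C suc m) * ((suc d + suc m) C suc d)
    ≡⟨ cong₂ _+_ (*-comm (n C m) _) (*-comm (n C suc m) _) ⟩
  ((d + suc m) C d) * (n C m) + ((suc d + suc m) C suc d) * (n C suc m)
    ≡⟨ cong₂ (λ a b → (a C d) * (n C m) + (b C suc d) * (n C suc m))
             (cong (_∸ 1) (sym (+-suc d (suc m)))) (cong (_∸ 1) (sym (+-suc (suc d) (suc m)))) ⟩
  ((suc d + suc (suc m) ∸ 2) C d) * (n C m) + ((suc d + suc (suc m) ∸ 1) C suc d) * (n C suc m) ∎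
  where open ≡-Reasoning

module _ {A B : Set} (F : A → List B) where

  length-concatMap : ∀ xs → length (concatMap F xs) ≡ sum (map (λ a → length (F a)) xs)
  length-concatMap []       = refl
  length-concatMap (a ∷ xs) = trans (length-++ (F a)) (cong (length (F a) +_) (length-concatMap xs))

  concatMap-unique : (key : B → A) → (∀ a → Unique (F a)) → (∀ a {b} → b ∈ F a → key b ≡ a) →
                     ∀ {xs} → Unique xs → Unique (concatMap F xs)
  concatMap-unique key unique keyed []             = []
  concatMap-unique key unique keyed {a ∷ xs} (a∉ ∷ u) =
    Unique.++⁺ (unique a) (concatMap-unique key unique keyed u) disjoint
    where
    disjoint : ∀ {b} → b ∈ F a × b ∈ concatMap F xs → ⊥
    disjoint (b∈Fa , b∈rest) with a′ , a′∈xs , b∈Fa′ ← find (∈-concatMap⁻ F b∈rest) =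
      All.lookup a∉ a′∈xs (trans (sym (keyed a b∈Fa)) (keyed a′ b∈Fa′))

positiveParts : List ℕ → ℕ
positiveParts []           = 0
positiveParts (zero  ∷ xs) = positiveParts xs
positiveParts (suc _ ∷ xs) = suc (positiveParts xs)

positiveParts-Positive : ∀ {ps} → Positive ps → positiveParts ps ≡ length ps
positiveParts-Positive []                    = refl
positiveParts-Positive {suc _ ∷ _} (_ ∷ pos) = cong suc (positiveParts-Positive pos)

positiveParts-∷ʳ0 : ∀ ps → positiveParts (ps ∷ʳ 0) ≡ positiveParts ps
positiveParts-∷ʳ0 []           = refl
positiveParts-∷ʳ0 (zero  ∷ ps) = positiveParts-∷ʳ0 ps
positiveParts-∷ʳ0 (suc _ ∷ ps) = cong suc (positiveParts-∷ʳ0 ps)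

-- Admissible sequences with exactly j + 1 positive clique parts.
sequencesWithParts : ℕ → ℕ → ℕ → List Sequence
sequencesWithParts n d j = positiveSequences n d (suc j) ++ zeroEndedSequences n d (suc (suc j))

allAdmissibleSequences : ℕ → ℕ → List Sequence
allAdmissibleSequences n d = concatMap (sequencesWithParts n d) (upTo n)

sequencesWithParts-parts : ∀ n d j {x} → x ∈ sequencesWithParts n d j → pred (positiveParts (proj₂ x)) ≡ j
sequencesWithParts-parts n d j x∈ with ∈-++⁻ (positiveSequences n d (suc j)) x∈
... | inj₁ x∈pos
  with ps , _ , ps∈ , _ , refl ←
         ∈-cartesianProductWith⁻ positiveSequence (compositions n (suc j)) (weakCompositions d (suc j)) x∈pos =
  let len , pos , _ = ∈-compositions⁻ n (suc j) ps∈ in cong pred (trans (positiveParts-Positive pos) len)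
sequencesWithParts-parts n (suc d) j x∈ | inj₂ x∈zero
  with ps , _ , ps∈ , _ , refl ←
         ∈-cartesianProductWith⁻ zeroEndedSequence (compositions n (suc j)) (weakCompositions d (suc (suc j))) x∈zero =
  let len , pos , _ = ∈-compositions⁻ n (suc j) ps∈ in cong pred (trans (positiveParts-∷ʳ0 ps) (trans (positiveParts-Positive pos) len))

allAdmissibleSequences-unique : ∀ n d → Unique (allAdmissibleSequences n d)
allAdmissibleSequences-unique n d =
  concatMap-unique (sequencesWithParts n d) (λ x → pred (positiveParts (proj₂ x)))
    (λ j → Unique.++⁺ (positiveSequences-unique n d (suc j)) (zeroEndedSequences-unique n d (suc (suc j)))
                      λ (x∈pos , x∈zero) → positive#zeroEnded n d (suc j) (suc (suc j)) x∈pos x∈zero)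
    (sequencesWithParts-parts n d) (Unique.upTo⁺ n)

length-sequencesWithParts : ∀ n d j → length (sequencesWithParts (suc n) d j) ≡ ((d + suc j) C d) * (n C j)
length-sequencesWithParts n zero j = begin
  length (positiveSequences (suc n) 0 (suc j) ++ []) ≡⟨ length-++ (positiveSequences (suc n) 0 (suc j)) ⟩
  length (positiveSequences (suc n) 0 (suc j)) + 0   ≡⟨ +-identityʳ _ ⟩
  length (positiveSequences (suc n) 0 (suc j))       ≡⟨ length-positiveSequences n 0 j ⟩
  (n C j) * (j C 0)                                  ≡⟨ cong ((n C j) *_) (trans (nC0≡1 j) (sym (nC0≡1 (suc j)))) ⟩
  (n C j) * (suc j C 0)                              ≡⟨ *-comm (n C j) _ ⟩
  (suc j C 0) * (n C j)                              ∎
  where open ≡-Reasoning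
length-sequencesWithParts n (suc d) j = begin
  length (positiveSequences (suc n) (suc d) (suc j) ++ zeroEndedSequences (suc n) (suc d) (suc (suc j)))
    ≡⟨ length-++ (positiveSequences (suc n) (suc d) (suc j)) ⟩
  length (positiveSequences (suc n) (suc d) (suc j)) + length (zeroEndedSequences (suc n) (suc d) (suc (suc j)))
    ≡⟨ cong₂ _+_ (length-positiveSequences n (suc d) j) (length-zeroEndedSequences n d j) ⟩
  (n C j) * ((suc d + j) C suc d) + (n C j) * ((d + suc j) C d)
    ≡⟨ sym (*-distribˡ-+ (n C j) _ _) ⟩
  (n C j) * ((suc d + j) C suc d + (d + suc j) C d)
    ≡⟨ cong (λ m → (n C j) * (m C suc d + (d + suc j) C d)) (sym (+-suc d j)) ⟩
  (n C j) * ((d + suc j) C suc d + (d + suc j) C d)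
    ≡⟨ cong ((n C j) *_) (trans (+-comm ((d + suc j) C suc d) _) (nCk+nC[k+1]≡[n+1]C[k+1] (d + suc j) d)) ⟩
  (n C j) * ((suc d + suc j) C suc d)
    ≡⟨ *-comm (n C j) _ ⟩
  ((suc d + suc j) C suc d) * (n C j) ∎
  where open ≡-Reasoning

length-allAdmissibleSequences : ∀ n d →
  length (allAdmissibleSequences (suc n) d) ≡ sumFrom1 (suc n) (λ k → ((d + k) C d) * ((suc n ∸ 1) C (k ∸ 1)))
length-allAdmissibleSequences n d =
  trans (length-concatMap (sequencesWithParts (suc n) d) (upTo (suc n)))
        (cong sum (map-cong (length-sequencesWithParts n d) (upTo (suc n))))

∈-allAdmissibleSequences⁻ : ∀ n d {x} → x ∈ allAdmissibleSequences (suc n) d → Σ ℕ λ k → 1 ≤ k × Admissible (suc n) d k x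
∈-allAdmissibleSequences⁻ n d x∈ with j , _ , x∈j ← find (∈-concatMap⁻ (sequencesWithParts (suc n) d) {xs = upTo (suc n)} x∈)
  with ∈-++⁻ (positiveSequences (suc n) d (suc j)) x∈j
... | inj₁ x∈pos  = suc j , s≤s z≤n , ∈-positiveSequences⁻ n d (suc j) x∈pos
... | inj₂ x∈zero = suc (suc j) , s≤s z≤n , ∈-zeroEndedSequences⁻ n d (suc (suc j)) x∈zero

∈-allAdmissibleSequences⁺ : ∀ n d {x} → (Σ ℕ λ k → 1 ≤ k × Admissible (suc n) d k x) → x ∈ allAdmissibleSequences (suc n) d
∈-allAdmissibleSequences⁺ n d {x} (k , 1≤k , admissible)
  with ∈-++⁻ (positiveSequences (suc n) d k) (∈-admissibleSequences⁺ n d k admissible)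
... | inj₁ x∈pos  = positive k 1≤k x∈pos
  where
  positive : ∀ k → 1 ≤ k → x ∈ positiveSequences (suc n) d k → x ∈ allAdmissibleSequences (suc n) d
  positive (suc j) _ x∈pos
    with ps , _ , ps∈ , _ , refl ←
           ∈-cartesianProductWith⁻ positiveSequence (compositions (suc n) (suc j)) (weakCompositions d (suc j)) x∈pos =
    ∈-concatMap⁺ (sequencesWithParts (suc n) d) (lose (∈-upTo⁺ (compositions-length≤ {suc n} {suc j} ps∈)) (∈-++⁺ˡ x∈pos))
... | inj₂ x∈zero = zeroEnded d k x∈zero
  where
  zeroEnded : ∀ d k → x ∈ zeroEndedSequences (suc n) d k → x ∈ allAdmissibleSequences (suc n) d
  zeroEnded (suc d′) (suc zero) x∈zero rewrite compositions-0 n with () ← x∈zero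
  zeroEnded (suc d′) (suc (suc j)) x∈zero
    with ps , _ , ps∈ , _ , refl ←
           ∈-cartesianProductWith⁻ zeroEndedSequence (compositions (suc n) (suc j)) (weakCompositions d′ (suc (suc j))) x∈zero =
    ∈-concatMap⁺ (sequencesWithParts (suc n) (suc d′))
      (lose (∈-upTo⁺ (compositions-length≤ {suc n} {suc j} ps∈)) (∈-++⁺ʳ (positiveSequences (suc n) (suc d′) (suc j)) x∈zero))

-- Counting

HasCard-list : ∀ {A : Set} {P : A → Set} (L : List A) → Unique L → (∀ {x} → x ∈ L → P x) → (∀ {x} → P x → x ∈ L) →
               HasCard P (length L)
HasCard-list L unique sound complete = L , unique , refl , λ _ → mk⇔ sound complete

HasCard-⇔ : ∀ {A : Set} {P Q : A → Set} {m} → (∀ x → P x ⇔ Q x) → HasCard P m → HasCard Q m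
HasCard-⇔ P⇔Q (L , unique , len , mem) = L , unique , len , λ x → ⇔.trans (mem x) (P⇔Q x)

HasCard-admissible : ∀ n d k → HasCard (Admissible (suc n) d k) (length (admissibleSequences (suc n) d k))
HasCard-admissible n d k = HasCard-list (admissibleSequences (suc n) d k) (admissibleSequences-unique (suc n) d k)
  (∈-admissibleSequences⁻ n d k) (∈-admissibleSequences⁺ n d k)

HasCard-ITCk : ∀ n d k {m} → length (admissibleSequences (suc n) d k) ≡ m → HasCard (ITCk (suc n) d k) m
HasCard-ITCk n d k refl = HasCard-⇔ (λ x → ⇔.sym (ITCk⇔Admissible (s≤s z≤n) k x)) (HasCard-admissible n d k)

HasCard-ITCall : ∀ n d → HasCard (ITCall (suc n) d) (length (allAdmissibleSequences (suc n) d))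
HasCard-ITCall n d =
  HasCard-⇔ (λ x → mk⇔ (λ (k , 1≤k , adm) → k , 1≤k , Equivalence.from (ITCk⇔Admissible (s≤s z≤n) k x) adm)
                       (λ (k , 1≤k , itc) → k , 1≤k , Equivalence.to (ITCk⇔Admissible (s≤s z≤n) k x) itc))
    (HasCard-list (allAdmissibleSequences (suc n) d) (allAdmissibleSequences-unique (suc n) d)
      (∈-allAdmissibleSequences⁻ n d) (∈-allAdmissibleSequences⁺ n d))

-- Opened only here: its prefix +_ would make the sections (x +_) above ambiguous.
open import Data.Integer using (+_; _-_)

lemmaB1 : (n d : ℕ) → 1 ≤ n →
    HasCard (ITCk n d 1) 1
    × (∀ k → 2 ≤ k →
         HasCard (ITCk n d k)
           (binomℤ (d + k ∸ 2) (+ d - + 1) * ((n ∸ 1) C (k ∸ 2))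
            + ((d + k ∸ 1) C d) * ((n ∸ 1) C (k ∸ 1))))
    × HasCard (ITCall n d) (sumFrom1 n (λ k → ((d + k) C d) * ((n ∸ 1) C (k ∸ 1))))
lemmaB1 (suc n) d _ =
    HasCard-ITCk n d 1 (length-admissibleSequences-1 n d)
  , (λ { (suc (suc m)) (s≤s (s≤s _)) → HasCard-ITCk n d (suc (suc m)) (length-admissibleSequences n d m) })
  , subst (HasCard (ITCall (suc n) d)) (length-allAdmissibleSequences n d) (HasCard-ITCall n d)
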